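{- Let $t$ be an odd positive integer and $k=(t+1)/2$. With the conventions $L^{(t)}_0(x)=1$ and $L^{(t)}_n(x)=0$ for $n<0$, for all $n\ge0$, \[ L^{(t)}_{n+1}(x)=xL^{(t)}_n(x)-(k!)^2\left(\binom{n}{k-1}^2+2\binom{n}{k}\binom{n}{k-1}\right)L^{(t)}_{n-(k-1)}(x)-\left(\binom{n}{t}\binom{t}{k}(k!)^2\right)^2L^{(t)}_{n-t}(x). \]
   Context: A $t$-path in a graph is a subgraph that is a path with $t$ edges on $t+1$ distinct vertices. For a graph $G$ on $N$ vertices, its higher-order matching polynomial is $M_t(G)=\sum_S(-1)^{|S|}x^{\,N-(t+1)|S|}$, summed over all sets $S$ of pairwise vertex-disjoint $t$-paths in $G$. For odd $t$, every $t$-path in the complete bipartite graph $K_{n,n}$ has $k=(t+1)/2$ vertices on each side, so $M_t(K_{n,n})$ is a polynomial in $x^2$; the Laguerre polynomial of order $t$ is defined by $L^{(t)}_n(x^2)=M_t(K_{n,n})$. -}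

module Defs where

open import Data.Nat using (ℕ; zero; suc; _+_; _*_; _∸_; _≡ᵇ_; _≤ᵇ_)
open import Data.Integer as ℤ using (ℤ; +_; -_)
open import Data.Fin using (Fin; zero; suc; inject₁)
open import Data.Vec using (Vec; lookup)
open import Data.Bool using (Bool; true; false; if_then_else_)
open import Data.Sum using (_⊎_; inj₁; inj₂)
open import Data.Product using (Σ; ∃; _×_; _,_)
open import Data.Empty using (⊥)
open import Data.Unit using (⊤)
open import Data.List using (List; length)
open import Data.List.Membership.Propositional using (_∈_)
open import Data.List.Relation.Unary.All using (All)
open import Data.List.Relation.Unary.AllPairs using (AllPairs)
open import Data.List.Relation.Unary.Unique.Propositional using (Unique)
open import Relation.Binary.PropositionalEquality using (_≡_)

-- The complete bipartite graph K_{n,n}.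
-- Vertices: inj₁ i (left side), inj₂ j (right side), i j : Fin n.
-- Edges: exactly the pairs {inj₁ i , inj₂ j}; an edge is named by (i , j).

Vertex : ℕ → Set
Vertex n = Fin n ⊎ Fin n

Adjacent : {n : ℕ} → Vertex n → Vertex n → Set
Adjacent (inj₁ _) (inj₂ _) = ⊤
Adjacent (inj₂ _) (inj₁ _) = ⊤
Adjacent (inj₁ _) (inj₁ _) = ⊥
Adjacent (inj₂ _) (inj₂ _) = ⊥

-- A set of edges of K_{n,n}: E[i][j] = true iff the edge {inj₁ i , inj₂ j} is in it.
EdgeSet : ℕ → Set
EdgeSet n = Vec (Vec Bool n) n

HasEdge : {n : ℕ} → EdgeSet n → Fin n → Fin n → Set
HasEdge E i j = lookup (lookup E i) j ≡ true

Joins : {n : ℕ} → Vertex n → Vertex n → Fin n → Fin n → Set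
Joins u v i j = (u ≡ inj₁ i × v ≡ inj₂ j) ⊎ (u ≡ inj₂ j × v ≡ inj₁ i)

record IsPathOf (t n : ℕ) (v : Vec (Vertex n) (suc t)) (E : EdgeSet n) : Set where
  field
    distinct : (p q : Fin (suc t)) → lookup v p ≡ lookup v q → p ≡ q
    adjacent : (p : Fin t) → Adjacent (lookup v (inject₁ p)) (lookup v (suc p))
    edges⇒   : (i j : Fin n) → HasEdge E i j →
               ∃ λ (p : Fin t) → Joins (lookup v (inject₁ p)) (lookup v (suc p)) i j
    edges⇐   : (i j : Fin n) (p : Fin t) →
               Joins (lookup v (inject₁ p)) (lookup v (suc p)) i j → HasEdge E i j

-- A t-path (as a subgraph of K_{n,n}), represented by its edge set
-- (for t ≥ 1 its vertex set is the set of endpoints of its edges).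
IsTPath : (t n : ℕ) → EdgeSet n → Set
IsTPath t n E = ∃ λ (v : Vec (Vertex n) (suc t)) → IsPathOf t n v E

VertexOf : {n : ℕ} → EdgeSet n → Vertex n → Set
VertexOf {n} E (inj₁ i) = ∃ λ (j : Fin n) → HasEdge E i j
VertexOf {n} E (inj₂ j) = ∃ λ (i : Fin n) → HasEdge E i j

VertexDisjoint : {n : ℕ} → EdgeSet n → EdgeSet n → Set
VertexDisjoint {n} E F = (w : Vertex n) → VertexOf E w → VertexOf F w → ⊥

-- A set S of j pairwise vertex-disjoint t-paths in K_{n,n}, given as a
-- duplicate-free list of its members (two lists denote the same set iff
-- they have the same members, see _≈S_ below).
PathSet : (t n j : ℕ) → Set
PathSet t n j =
  Σ (List (EdgeSet n)) λ S →
    Unique S × length S ≡ j × All (IsTPath t n) S × AllPairs VertexDisjoint S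

_≈S_ : {t n j : ℕ} → PathSet t n j → PathSet t n j → Set
_≈S_ {n = n} (S , _) (S′ , _) =
  (E : EdgeSet n) → (E ∈ S → E ∈ S′) × (E ∈ S′ → E ∈ S)

HasCardUpTo : (A : Set) → (A → A → Set) → ℕ → Set
HasCardUpTo A _≈_ m =
  Σ (Fin m → A) λ f →
    ((a : A) → ∃ λ (i : Fin m) → f i ≈ a) ×
    ((i i′ : Fin m) → f i ≈ f i′ → i ≡ i′)

IsPathSetCount : (t : ℕ) → (ℕ → ℕ → ℕ) → Set
IsPathSetCount t c = (n j : ℕ) → HasCardUpTo (PathSet t n j) _≈S_ (c n j)

-- Polynomials with integer coefficients, as coefficient functions ℕ → ℤ.

sumTo : ℕ → (ℕ → ℤ) → ℤ
sumTo zero    f = f 0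
sumTo (suc N) f = sumTo N f ℤ.+ f (suc N)

signℤ : ℕ → ℤ
signℤ zero    = + 1
signℤ (suc j) = - signℤ j

-- Coefficient of x^e in M_t(K_{n,n}) = Σ_S (-1)^|S| x^{2n - (t+1)|S|},
-- where c n j counts the sets S with |S| = j (|S| ≤ 2n always).
Mcoeff : (t : ℕ) → (ℕ → ℕ → ℕ) → ℕ → ℕ → ℤ
Mcoeff t c n e =
  sumTo (2 * n) λ j →
    if ((t + 1) * j + e ≡ᵇ 2 * n) then signℤ j ℤ.* + (c n j) else + 0

-- L^{(t)}_n, defined by L^{(t)}_n(x²) = M_t(K_{n,n}): coefficient of x^d.
Lcoeff : (t : ℕ) → (ℕ → ℕ → ℕ) → ℕ → ℕ → ℤ
Lcoeff t c n d = Mcoeff t c n (2 * d)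

LcoeffSub : (t : ℕ) → (ℕ → ℕ → ℕ) → ℕ → ℕ → ℕ → ℤ
LcoeffSub t c n m d = if m ≤ᵇ n then Lcoeff t c (n ∸ m) d else + 0

xTimes : (ℕ → ℤ) → ℕ → ℤ
xTimes p zero    = + 0
xTimes p (suc d) = p d

-- Since t = 2k + 1 is odd (k here is the paper's k − 1, and K = k + 1 the paper's k), a t-path in
-- K_{n,n} has exactly one end on the left, and read from that end it is a zigzag of K distinct left
-- and K distinct right vertices. Counting sets of j disjoint such paths inside sides of sizes a and b
-- by whether a fixed left vertex is used gives j! · count = a↓(jK) · b↓(jK), so j! c(n, j) = (n↓jK)².
-- The coefficient of x^d in L_{n+1} is (−1)^j c(n + 1, j) for the unique j with jK + d = n + 1 (if any),
-- and the matching coefficients on the right involve c at j, j − 1 and j − 2; after clearing factorials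
-- the recurrence becomes a polynomial identity, via Pascal's rule (n + 1)↓(m + 1) = n↓(m + 1) + (m + 1) n↓m.
module Submission where

open import Defs

open import Data.Bool as Bool using (Bool; true; false; not; _∧_; if_then_else_)
open import Data.Bool.Properties using (not-involutive; T-≡; ¬-not)
open import Data.Empty using (⊥-elim)
open import Data.Fin using (Fin; zero; suc; toℕ; fromℕ<; inject₁; splitAt; _↑ˡ_; _↑ʳ_; join; combine; remQuot)
open import Data.Fin.Properties
  using (_≟_; any?; toℕ-injective; toℕ<n; toℕ-fromℕ<; toℕ-inject₁; injective⇒≤;
         splitAt-↑ˡ; splitAt-↑ʳ; join-splitAt; remQuot-combine; combine-remQuot)
import Data.Fin.Properties as Finₚ
open import Data.Integer as ℤ using (ℤ; +_; -_) renaming (_-_ to _-ℤ_; _*_ to _*ℤ_)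
import Data.Integer.Properties as ℤₚ
import Data.Integer.Tactic.RingSolver as ℤSolver
open import Data.List using ([]; _∷_)
open import Data.List.Membership.Propositional using (_∈_)
open import Data.List.Membership.Propositional.Properties using (∈-lookup)
open import Data.List.Properties using (length-removeAt′)
open import Data.List.Relation.Unary.All as All using (All; []; _∷_)
import Data.List.Relation.Unary.All.Properties as All
open import Data.List.Relation.Unary.AllPairs using (AllPairs; []; _∷_)
open import Data.List.Relation.Unary.Any as Any using (Any; here; there; _─_)
open import Data.List.Relation.Unary.Any.Properties using (lookup-result)
open import Data.Nat using (ℕ; zero; suc; _+_; _*_; _∸_; _^_; _≤_; _<_; z≤n; s≤s; _!; _≡ᵇ_)
  renaming (_≟_ to _≟ℕ_)
open import Data.Nat.Combinatorics using (_C_; nCk+nC[k+1]≡[n+1]C[k+1]; k>n⇒nCk≡0)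
open import Data.Nat.Properties
  using (≤-refl; ≤-reflexive; ≤-trans; ≤-antisym; ≤-pred; <⇒≤; _≤?_; m≤m+n; m≤n+m; m≤n⇒m≤1+n;
         m≤n⇒m<n∨m≡n; ≤∧≢⇒<; 1+n≰n; 1+n≢0; suc-injective; anyUpTo?;
         +-comm; +-assoc; +-suc; +-identityʳ; +-cancelˡ-≡; +-cancelʳ-≡;
         *-comm; *-assoc; *-identityʳ; *-zeroʳ; *-distribˡ-+; *-distribʳ-+; *-cancelˡ-≡; _!≢0;
         m+n∸n≡m; m+n∸m≡n; m+[n∸m]≡n; m∸n≤m; m∸[m∸n]≡n; ∸-cancelˡ-≡; ≡ᵇ⇒≡; ≡⇒≡ᵇ; ≤ᵇ⇒≤; ≤⇒≤ᵇ)
open import Data.Nat.Tactic.RingSolver using (solve-∀)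
open import Data.Product using (Σ; ∃; _×_; _,_; proj₁; proj₂)
open import Data.Sum using (_⊎_; inj₁; inj₂; [_,_]′; reduce)
open import Data.Sum.Properties using (inj₁-injective; inj₂-injective; ≡-dec)
open import Data.Sum.Relation.Binary.Pointwise using (Pointwise; inj₁; inj₂)
open import Data.Vec using (Vec; []; _∷_; lookup; tabulate)
open import Data.Vec.Properties using (lookup∘tabulate; tabulate∘lookup; tabulate-cong)
open import Function using (_on_; _∘_; case_of_; Equivalence)
open import Level using (0ℓ)
open import Relation.Binary.Core using (Rel)
import Relation.Binary.Construct.On as On
open import Relation.Binary.PropositionalEquality
  using (_≡_; _≢_; refl; sym; trans; cong; cong₂; subst; subst₂; isEquivalence; module ≡-Reasoning)
open import Relation.Binary.Structures using (IsEquivalence)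
open import Relation.Nullary using (Dec; yes; no; ¬_)
open import Relation.Nullary.Decidable using (⌊_⌋; does; dec-true; _×-dec_; _⊎-dec_)
open ≡-Reasoning

module _ {A : Set} {_≈_ : Rel A 0ℓ} (≈-equiv : IsEquivalence _≈_) where
  private module ≈ = IsEquivalence ≈-equiv

  card-≤ : ∀ {m m′} → HasCardUpTo A _≈_ m → HasCardUpTo A _≈_ m′ → m ≤ m′
  card-≤ {m} {m′} (f , f-onto , f-inj) (g , g-onto , g-inj) = injective⇒≤ {f = index} index-injective
    where
    index : Fin m → Fin m′
    index i = proj₁ (g-onto (f i))
    index-injective : ∀ {i i′} → index i ≡ index i′ → i ≡ i′
    index-injective {i} {i′} e = f-inj i i′ (≈.trans (≈.sym (proj₂ (g-onto (f i))))
      (subst (λ r → g r ≈ f i′) (sym e) (proj₂ (g-onto (f i′)))))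

  card-unique : ∀ {m m′} → HasCardUpTo A _≈_ m → HasCardUpTo A _≈_ m′ → m ≡ m′
  card-unique c c′ = ≤-antisym (card-≤ c c′) (card-≤ c′ c)

card-transport : ∀ {A B : Set} {_≈A_ : Rel A 0ℓ} {_≈B_ : Rel B 0ℓ} {m} →
  IsEquivalence _≈B_ → (h : A → B) →
  (∀ a a′ → a ≈A a′ → h a ≈B h a′) → (∀ a a′ → h a ≈B h a′ → a ≈A a′) →
  (∀ b → ∃ λ a → h a ≈B b) →
  HasCardUpTo A _≈A_ m → HasCardUpTo B _≈B_ m
card-transport ≈B-equiv h h-cong h-inj h-onto (f , f-onto , f-inj) =
  (λ i → h (f i)) ,
  (λ b → let (a , ha≈b) = h-onto b ; (i , fi≈a) = f-onto a
         in i , IsEquivalence.trans ≈B-equiv (h-cong _ _ fi≈a) ha≈b) ,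
  (λ i i′ e → f-inj i i′ (h-inj _ _ e))

card-⊎ : ∀ {A B : Set} {_≈A_ : Rel A 0ℓ} {_≈B_ : Rel B 0ℓ} {m m′} →
  HasCardUpTo A _≈A_ m → HasCardUpTo B _≈B_ m′ →
  HasCardUpTo (A ⊎ B) (Pointwise _≈A_ _≈B_) (m + m′)
card-⊎ {A} {B} {_≈A_} {_≈B_} {m} {m′} (f , f-onto , f-inj) (g , g-onto , g-inj) =
  h∘splitAt , onto , injective
  where
  _≈_ : Rel (A ⊎ B) 0ℓ
  _≈_ = Pointwise _≈A_ _≈B_
  h : Fin m ⊎ Fin m′ → A ⊎ B
  h (inj₁ i) = inj₁ (f i)
  h (inj₂ i) = inj₂ (g i)
  h∘splitAt : Fin (m + m′) → A ⊎ B
  h∘splitAt k = h (splitAt m k)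
  onto : ∀ z → ∃ λ k → h∘splitAt k ≈ z
  onto (inj₁ a) = let (i , e) = f-onto a in
    i ↑ˡ m′ , subst (λ w → h w ≈ inj₁ a) (sym (splitAt-↑ˡ m i m′)) (inj₁ e)
  onto (inj₂ b) = let (i , e) = g-onto b in
    m ↑ʳ i , subst (λ w → h w ≈ inj₂ b) (sym (splitAt-↑ʳ m m′ i)) (inj₂ e)
  h-injective : ∀ w w′ → h w ≈ h w′ → w ≡ w′
  h-injective (inj₁ i) (inj₁ i′) (inj₁ e) = cong inj₁ (f-inj i i′ e)
  h-injective (inj₂ i) (inj₂ i′) (inj₂ e) = cong inj₂ (g-inj i i′ e)
  injective : ∀ k k′ → h∘splitAt k ≈ h∘splitAt k′ → k ≡ k′
  injective k k′ e = trans (sym (join-splitAt m m′ k))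
    (trans (cong (join m m′) (h-injective (splitAt m k) (splitAt m k′) e)) (join-splitAt m m′ k′))

Graph : {A B : Set} → (A → B → Set) → Set
Graph {A} {B} Q = Σ A λ a → Σ B (Q a)

_×≈_ : {A B : Set} {Q : A → B → Set} → Rel A 0ℓ → Rel B 0ℓ → Rel (Graph Q) 0ℓ
(_≈A_ ×≈ _≈B_) (a , b , _) (a′ , b′ , _) = a ≈A a′ × b ≈B b′

card-Graph : ∀ {A B : Set} {_≈A_ : Rel A 0ℓ} {_≈B_ : Rel B 0ℓ} {Q : A → B → Set} {m m′} →
  IsEquivalence _≈A_ → (∀ a a′ b → a ≈A a′ → Q a b → Q a′ b) →
  HasCardUpTo A _≈A_ m → (∀ a → HasCardUpTo (Σ B (Q a)) (_≈B_ on proj₁) m′) →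
  HasCardUpTo (Graph Q) (_≈A_ ×≈ _≈B_) (m * m′)
card-Graph {_≈A_ = _≈A_} {_≈B_} {Q} {m} {m′} ≈A-equiv Q-resp (f , f-onto , f-inj) fibre =
  h∘remQuot , onto , injective
  where
  _≈_ : Rel (Graph Q) 0ℓ
  _≈_ = _≈A_ ×≈ _≈B_
  h : Fin m → Fin m′ → Graph Q
  h i r = f i , proj₁ (fibre (f i)) r
  h∘remQuot : Fin (m * m′) → Graph Q
  h∘remQuot k = let (i , r) = remQuot m′ k in h i r
  onto : ∀ z → ∃ λ k → h∘remQuot k ≈ z
  onto (a , b , q) =
    let (i , fi≈a) = f-onto a
        (r , e) = proj₁ (proj₂ (fibre (f i))) (b , Q-resp _ _ _ (IsEquivalence.sym ≈A-equiv fi≈a) q)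
    in combine i r ,
       subst (λ w → h (proj₁ w) (proj₂ w) ≈ (a , b , q)) (sym (remQuot-combine i r)) (fi≈a , e)
  h-injective : ∀ i r i′ r′ → h i r ≈ h i′ r′ → (i , r) ≡ (i′ , r′)
  h-injective i r i′ r′ (e₁ , e₂) with f-inj i i′ e₁
  ... | refl = cong (i ,_) (proj₂ (proj₂ (fibre (f i))) r r′ e₂)
  injective : ∀ k k′ → h∘remQuot k ≈ h∘remQuot k′ → k ≡ k′
  injective k k′ e = trans (sym (combine-remQuot {m} m′ k))
    (trans (cong (λ w → combine (proj₁ w) (proj₂ w)) (h-injective _ _ _ _ e))
           (combine-remQuot {m} m′ k′))

private
  filter-family : ∀ {A : Set} {_≈_ : Rel A 0ℓ} → IsEquivalence _≈_ →
    (P : A → Set) → (∀ a → Dec (P a)) →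
    ∀ m (f : Fin m → A) → (∀ i i′ → f i ≈ f i′ → i ≡ i′) →
    ∃ λ m′ → Σ (Fin m′ → Σ A P) λ g →
      (∀ i → P (f i) → ∃ λ r → proj₁ (g r) ≈ f i) ×
      (∀ r → ∃ λ i → proj₁ (g r) ≈ f i) ×
      (∀ r r′ → proj₁ (g r) ≈ proj₁ (g r′) → r ≡ r′)
  filter-family ≈-equiv P P? zero f f-inj = zero , (λ ()) , (λ ()) , (λ ()) , (λ ())
  filter-family {A} {_≈_} ≈-equiv P P? (suc m) f f-inj
    with filter-family ≈-equiv P P? m (λ i → f (suc i)) (λ i i′ e → Finₚ.suc-injective (f-inj _ _ e))
       | P? (f zero)
  ... | m′ , g , hit , from , g-inj | no ¬p = m′ , g , hit′ , from′ , g-inj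
    where
    hit′ : ∀ i → P (f i) → ∃ λ r → proj₁ (g r) ≈ f i
    hit′ zero p = ⊥-elim (¬p p)
    hit′ (suc i) p = hit i p
    from′ : ∀ r → ∃ λ i → proj₁ (g r) ≈ f i
    from′ r = let (i , e) = from r in suc i , e
  ... | m′ , g , hit , from , g-inj | yes p = suc m′ , g′ , hit′ , from′ , g′-inj
    where
    module ≈ = IsEquivalence ≈-equiv
    g′ : Fin (suc m′) → Σ A P
    g′ zero = f zero , p
    g′ (suc r) = g r
    hit′ : ∀ i → P (f i) → ∃ λ r → proj₁ (g′ r) ≈ f i
    hit′ zero _ = zero , ≈.refl
    hit′ (suc i) q = let (r , e) = hit i q in suc r , e
    from′ : ∀ r → ∃ λ i → proj₁ (g′ r) ≈ f i
    from′ zero = zero , ≈.refl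
    from′ (suc r) = let (i , e) = from r in suc i , e
    g′-inj : ∀ r r′ → proj₁ (g′ r) ≈ proj₁ (g′ r′) → r ≡ r′
    g′-inj zero zero _ = refl
    g′-inj zero (suc r′) e with from r′
    ... | i , e′ with () ← f-inj zero (suc i) (≈.trans e e′)
    g′-inj (suc r) zero e with from r
    ... | i , e′ with () ← f-inj zero (suc i) (≈.trans (≈.sym e) e′)
    g′-inj (suc r) (suc r′) e = cong suc (g-inj r r′ e)

card-Σ-dec : ∀ {A : Set} {_≈_ : Rel A 0ℓ} {m} → IsEquivalence _≈_ → (P : A → Set) →
  (∀ a → Dec (P a)) → (∀ {a a′} → a ≈ a′ → P a → P a′) →
  HasCardUpTo A _≈_ m → ∃ λ m′ → HasCardUpTo (Σ A P) (_≈_ on proj₁) m′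
card-Σ-dec {_≈_ = _≈_} ≈-equiv P P? P-resp (f , f-onto , f-inj)
  with filter-family ≈-equiv P P? _ f f-inj
... | m′ , g , hit , _ , g-inj = m′ , g , onto , g-inj
  where
  module ≈ = IsEquivalence ≈-equiv
  onto : ∀ z → ∃ λ r → proj₁ (g r) ≈ proj₁ z
  onto (a , pa) = let (i , e) = f-onto a ; (r , e′) = hit i (P-resp (≈.sym e) pa) in r , ≈.trans e′ e

≡-on-proj₁ : {B : Set} {Q : B → Set} → IsEquivalence {A = Σ B Q} (_≡_ on proj₁)
≡-on-proj₁ = On.isEquivalence proj₁ isEquivalence

module _ {A : Set} {P : A → Set} where

  ∈-─⁻ : ∀ {xs z} (p : Any P xs) → z ∈ (xs ─ p) → z ∈ xs
  ∈-─⁻ (here _)  z∈      = there z∈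
  ∈-─⁻ (there p) (here e)  = here e
  ∈-─⁻ (there p) (there z∈) = there (∈-─⁻ p z∈)

  ∈-─⁺ : ∀ {xs z} (p : Any P xs) → z ∈ xs → z ≡ Any.lookup p ⊎ z ∈ (xs ─ p)
  ∈-─⁺ (here _)  (here e)   = inj₁ e
  ∈-─⁺ (here _)  (there z∈) = inj₂ z∈
  ∈-─⁺ (there p) (here e)   = inj₂ (here e)
  ∈-─⁺ (there p) (there z∈) with ∈-─⁺ p z∈
  ... | inj₁ e   = inj₁ e
  ... | inj₂ z∈′ = inj₂ (there z∈′)

  AllPairs-─ : ∀ {R : A → A → Set} {xs} → (∀ {x y} → R x y → R y x) → (p : Any P xs) → AllPairs R xs →
    AllPairs R (xs ─ p) × All (R (Any.lookup p)) (xs ─ p)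
  AllPairs-─ R-sym (here _)  (rs ∷ pairs) = pairs , rs
  AllPairs-─ R-sym (there p) (rs ∷ pairs) with AllPairs-─ R-sym p pairs
  ... | pairs′ , rs′ = (All.─⁺ p rs ∷ pairs′) , (R-sym (All.lookup rs (∈-lookup (Any.index p))) ∷ rs′)

Sub : ℕ → Set
Sub n = Fin n → Bool

_∈ₛ_ : ∀ {n} → Fin n → Sub n → Set
i ∈ₛ L = L i ≡ true

_∖_ : ∀ {n} → Sub n → Sub n → Sub n
(L ∖ V) i = L i ∧ not (V i)

⁅_⁆ : ∀ {n} → Fin n → Sub n
⁅ x ⁆ i = ⌊ i ≟ x ⌋

HasSize : ∀ {n} → Sub n → ℕ → Set
HasSize {n} L a = HasCardUpTo (Σ (Fin n) (_∈ₛ L)) (_≡_ on proj₁) a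

∈-∖⁻ : ∀ {n} (L V : Sub n) i → i ∈ₛ (L ∖ V) → i ∈ₛ L × ¬ i ∈ₛ V
∈-∖⁻ L V i h with L i | V i
∈-∖⁻ L V i () | false | _
∈-∖⁻ L V i () | true  | true
... | true | false = refl , λ ()

∈-∖⁺ : ∀ {n} (L V : Sub n) i → i ∈ₛ L → ¬ i ∈ₛ V → i ∈ₛ (L ∖ V)
∈-∖⁺ L V i i∈L i∉V with L i | V i
... | false | _     = i∈L
... | true  | true  = ⊥-elim (i∉V refl)
... | true  | false = refl

∈-⁅⁆⁻ : ∀ {n} {x i : Fin n} → i ∈ₛ ⁅ x ⁆ → i ≡ x
∈-⁅⁆⁻ {x = x} {i} h with i ≟ x
... | yes i≡x = i≡x

x∈⁅x⁆ : ∀ {n} (x : Fin n) → x ∈ₛ ⁅ x ⁆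
x∈⁅x⁆ x with x ≟ x
... | yes _  = refl
... | no x≢x = ⊥-elim (x≢x refl)

_∈?ₛ_ : ∀ {n} i (L : Sub n) → Dec (i ∈ₛ L)
i ∈?ₛ L = L i Bool.≟ true

size-exists : ∀ {n} (L : Sub n) → ∃ (HasSize L)
size-exists {n} L = card-Σ-dec isEquivalence (_∈ₛ L) (_∈?ₛ L) (λ { refl h → h })
  ((λ i → i) , (λ i → i , refl) , (λ _ _ e → e))

size-∖ : ∀ {n} (L V : Sub n) {a b} → (∀ i → i ∈ₛ V → i ∈ₛ L) →
  HasSize L a → HasSize V b → HasSize (L ∖ V) (a ∸ b)
size-∖ {n} L V {a} {b} V⊆L size-L size-V with size-exists (L ∖ V)
... | c , size-L∖V = subst (HasSize (L ∖ V)) c≡a∸b size-L∖V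
  where
  h : Σ (Fin n) (_∈ₛ (L ∖ V)) ⊎ Σ (Fin n) (_∈ₛ V) → Σ (Fin n) (_∈ₛ L)
  h (inj₁ (i , p)) = i , proj₁ (∈-∖⁻ L V i p)
  h (inj₂ (i , p)) = i , V⊆L i p
  _≈_ : Rel (Σ (Fin n) (_∈ₛ (L ∖ V)) ⊎ Σ (Fin n) (_∈ₛ V)) 0ℓ
  _≈_ = Pointwise (_≡_ on proj₁) (_≡_ on proj₁)
  h-cong : ∀ z z′ → z ≈ z′ → proj₁ (h z) ≡ proj₁ (h z′)
  h-cong _ _ (inj₁ e) = e
  h-cong _ _ (inj₂ e) = e
  h-inj : ∀ z z′ → proj₁ (h z) ≡ proj₁ (h z′) → z ≈ z′
  h-inj (inj₁ _) (inj₁ _) e = inj₁ e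
  h-inj (inj₂ _) (inj₂ _) e = inj₂ e
  h-inj (inj₁ (i , p)) (inj₂ (_ , p′)) refl = ⊥-elim (proj₂ (∈-∖⁻ L V i p) p′)
  h-inj (inj₂ (i , p)) (inj₁ (_ , p′)) refl = ⊥-elim (proj₂ (∈-∖⁻ L V i p′) p)
  h-onto : ∀ w → ∃ λ z → proj₁ (h z) ≡ proj₁ w
  h-onto (i , p) with i ∈?ₛ V
  ... | yes i∈V = inj₂ (i , i∈V) , refl
  ... | no  i∉V = inj₁ (i , ∈-∖⁺ L V i p i∉V) , refl
  c+b≡a : c + b ≡ a
  c+b≡a = card-unique ≡-on-proj₁
    (card-transport ≡-on-proj₁ h h-cong h-inj h-onto (card-⊎ size-L∖V size-V)) size-L
  c≡a∸b : c ≡ a ∸ b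
  c≡a∸b = trans (sym (m+n∸n≡m c b)) (cong (_∸ b) c+b≡a)

size-⁅⁆ : ∀ {n} (x : Fin n) → HasSize ⁅ x ⁆ 1
size-⁅⁆ x = (λ _ → x , x∈⁅x⁆ x) , (λ { (i , p) → zero , sym (∈-⁅⁆⁻ p) }) , λ { zero zero _ → refl }

size-remove : ∀ {n} (L : Sub n) {x a} → x ∈ₛ L → HasSize L (suc a) → HasSize (L ∖ ⁅ x ⁆) a
size-remove L {x} x∈L size-L =
  size-∖ L ⁅ x ⁆ (λ i i∈⁅x⁆ → subst (_∈ₛ L) (sym (∈-⁅⁆⁻ i∈⁅x⁆)) x∈L) size-L (size-⁅⁆ x)

size-zero-empty : ∀ {n} (L : Sub n) {i} → i ∈ₛ L → ¬ HasSize L 0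
size-zero-empty L i∈L (_ , onto , _) with onto (_ , i∈L)
... | () , _

infix 8 _↓_

_↓_ : ℕ → ℕ → ℕ
a     ↓ zero  = 1
zero  ↓ suc m = 0
suc a ↓ suc m = suc a * a ↓ m

↓-pascal : ∀ a k → suc a ↓ suc k ≡ a ↓ suc k + suc k * a ↓ k
↓-pascal zero    zero    = refl
↓-pascal zero    (suc k) = sym (*-zeroʳ (suc (suc k)))
↓-pascal (suc a) zero    = cong suc (sym (+-comm (a * 1) 1))
↓-pascal (suc a) (suc k) = begin
  suc A * (A * F)          ≡⟨ expand A F ⟩
  A * (A * F) + A * F      ≡⟨ cong (λ z → A * z + A * F) (↓-pascal a k) ⟩
  A * (X + K * F) + A * F  ≡⟨ collect A X K F ⟩
  A * X + suc K * (A * F)  ∎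
  where
  A F X K : ℕ
  A = suc a
  F = a ↓ k
  X = a ↓ suc k
  K = suc k
  expand : ∀ A F → suc A * (A * F) ≡ A * (A * F) + A * F
  expand = solve-∀
  collect : ∀ A X K F → A * (X + K * F) + A * F ≡ A * X + suc K * (A * F)
  collect = solve-∀

^2≡* : ∀ x → x ^ 2 ≡ x * x
^2≡* x = cong (x *_) (*-identityʳ x)

↓-+ : ∀ a p q → a ↓ (p + q) ≡ a ↓ p * (a ∸ p) ↓ q
↓-+ a       zero    q = sym (+-identityʳ (a ↓ q))
↓-+ zero    (suc p) q = refl
↓-+ (suc a) (suc p) q = trans (cong (suc a *_) (↓-+ a p q)) (sym (*-assoc (suc a) (a ↓ p) _))

↓-1 : ∀ a → a ↓ 1 ≡ a
↓-1 zero    = refl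
↓-1 (suc a) = *-identityʳ (suc a)

↓-suc : ∀ a m → a ↓ suc m ≡ a ↓ m * (a ∸ m)
↓-suc a m = trans (cong (a ↓_) (+-comm 1 m)) (trans (↓-+ a m 1) (cong (a ↓ m *_) (↓-1 (a ∸ m))))

↓-zero : ∀ {a m} → a < m → a ↓ m ≡ 0
↓-zero {zero}  {suc m} _         = refl
↓-zero {suc a} {suc m} (s≤s a<m) = trans (cong (suc a *_) (↓-zero a<m)) (*-zeroʳ (suc a))

C*!≡↓ : ∀ n k → (n C k) * k ! ≡ n ↓ k
C*!≡↓ n       zero    = refl
C*!≡↓ zero    (suc k) = cong (_* suc k !) (k>n⇒nCk≡0 {0} {suc k} (s≤s z≤n))
C*!≡↓ (suc n) (suc k) = begin
  (suc n C suc k) * suc k !                         ≡⟨ cong (_* suc k !) (sym (nCk+nC[k+1]≡[n+1]C[k+1] n k)) ⟩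
  ((n C k) + (n C suc k)) * (suc k * k !)           ≡⟨ regroup (n C k) (n C suc k) k (k !) ⟩
  (n C suc k) * suc k ! + suc k * ((n C k) * k !)
    ≡⟨ cong₂ (λ x y → x + suc k * y) (C*!≡↓ n (suc k)) (C*!≡↓ n k) ⟩
  n ↓ suc k + suc k * n ↓ k                         ≡⟨ sym (↓-pascal n k) ⟩
  suc n ↓ suc k                                     ∎
  where
  regroup : ∀ x y k f → (x + y) * (suc k * f) ≡ y * (suc k * f) + suc k * (x * f)
  regroup = solve-∀

↓*!≡! : ∀ p q → (p + q) ↓ p * q ! ≡ (p + q) !
↓*!≡! zero    q = +-identityʳ (q !)
↓*!≡! (suc p) q = trans (*-assoc (suc (p + q)) ((p + q) ↓ p) (q !)) (cong (suc (p + q) *_) (↓*!≡! p q))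

Distinct : ∀ {A : Set} {m} → Vec A m → Set
Distinct v = ∀ p q → lookup v p ≡ lookup v q → p ≡ q

Arranged : ∀ {n m} → Sub n → Vec (Fin n) m → Set
Arranged L v = (∀ p → lookup v p ∈ₛ L) × Distinct v

Arrangement : ∀ {n} → Sub n → ℕ → Set
Arrangement {n} L m = Σ (Vec (Fin n) m) (Arranged L)

card-Arrangement : ∀ {n} (L : Sub n) m {a} → HasSize L a →
  HasCardUpTo (Arrangement L m) (_≡_ on proj₁) (a ↓ m)
card-Arrangement L zero _ =
  (λ _ → [] , (λ ()) , (λ ())) , (λ { ([] , _) → zero , refl }) , λ { zero zero _ → refl }
card-Arrangement L (suc m) {zero} size-L =
  (λ ()) , (λ { (v , v∈L , _) → ⊥-elim (size-zero-empty L (v∈L zero) size-L) }) , (λ ())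
card-Arrangement {n} L (suc m) {suc a} size-L =
  card-transport ≡-on-proj₁ cons cons-cong cons-inj cons-onto
    (card-Graph {_≈B_ = _≡_} ≡-on-proj₁ (λ { _ _ _ refl q → q }) size-L
      (λ { (x , x∈L) → card-Arrangement (L ∖ ⁅ x ⁆) m (size-remove L x∈L size-L) }))
  where
  Tail : Σ (Fin n) (_∈ₛ L) → Vec (Fin n) m → Set
  Tail (x , _) = Arranged (L ∖ ⁅ x ⁆)
  cons : Graph Tail → Arrangement L (suc m)
  cons ((x , x∈L) , v , v∈L-x , v-distinct) = x ∷ v , ∈L , distinct
    where
    x∉v : ∀ p → lookup v p ≢ x
    x∉v p e = proj₂ (∈-∖⁻ L ⁅ x ⁆ _ (v∈L-x p)) (subst (_∈ₛ ⁅ x ⁆) (sym e) (x∈⁅x⁆ x))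
    ∈L : ∀ p → lookup (x ∷ v) p ∈ₛ L
    ∈L zero = x∈L
    ∈L (suc p) = proj₁ (∈-∖⁻ L ⁅ x ⁆ _ (v∈L-x p))
    distinct : Distinct (x ∷ v)
    distinct zero    zero    _ = refl
    distinct zero    (suc q) e = ⊥-elim (x∉v q (sym e))
    distinct (suc p) zero    e = ⊥-elim (x∉v p e)
    distinct (suc p) (suc q) e = cong suc (v-distinct p q e)
  cons-cong : ∀ z z′ → ((_≡_ on proj₁) ×≈ _≡_) z z′ → proj₁ (cons z) ≡ proj₁ (cons z′)
  cons-cong _ _ (refl , refl) = refl
  cons-inj : ∀ z z′ → proj₁ (cons z) ≡ proj₁ (cons z′) → ((_≡_ on proj₁) ×≈ _≡_) z z′
  cons-inj ((x , _) , v , _) ((x′ , _) , v′ , _) refl = refl , refl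
  cons-onto : ∀ w → ∃ λ z → proj₁ (cons z) ≡ proj₁ w
  cons-onto (x ∷ v , ∈L , distinct) =
    ((x , ∈L zero) , v , (λ p → ∈-∖⁺ L ⁅ x ⁆ _ (∈L (suc p)) (x∉v p)) ,
                         (λ p q e → Finₚ.suc-injective (distinct (suc p) (suc q) e))) , refl
    where
    x∉v : ∀ p → ¬ lookup v p ∈ₛ ⁅ x ⁆
    x∉v p h with () ← distinct (suc p) zero (∈-⁅⁆⁻ h)

-- Indices past the end return the last entry; only indices ≤ m are ever used.
at : ∀ {A : Set} {m} → Vec A (suc m) → ℕ → A
at (x ∷ _)          zero    = x
at (x ∷ [])         (suc _) = x
at (_ ∷ v@(_ ∷ _)) (suc i) = at v i

lookup≡at : ∀ {A : Set} {m} (v : Vec A (suc m)) p → lookup v p ≡ at v (toℕ p)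
lookup≡at (x ∷ _)          zero    = refl
lookup≡at (_ ∷ v@(_ ∷ _)) (suc p) = lookup≡at v p

lookup-fromℕ<≡at : ∀ {A : Set} {m} (v : Vec A (suc m)) {q} (q≤m : q ≤ m) →
  lookup v (fromℕ< (s≤s q≤m)) ≡ at v q
lookup-fromℕ<≡at v q≤m = trans (lookup≡at v _) (cong (at v) (toℕ-fromℕ< (s≤s q≤m)))

lookup-inject₁≡at : ∀ {A : Set} {m} (v : Vec A (suc m)) p → lookup v (inject₁ p) ≡ at v (toℕ p)
lookup-inject₁≡at v p = trans (lookup≡at v (inject₁ p)) (cong (at v) (toℕ-inject₁ p))

at-injective : ∀ {A : Set} {m} (v : Vec A (suc m)) → Distinct v →
  ∀ {q q′} → q ≤ m → q′ ≤ m → at v q ≡ at v q′ → q ≡ q′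
at-injective v v-distinct q≤m q′≤m e =
  trans (sym (toℕ-fromℕ< (s≤s q≤m))) (trans (cong toℕ (v-distinct _ _
    (trans (lookup-fromℕ<≡at v q≤m) (trans e (sym (lookup-fromℕ<≡at v q′≤m))))))
    (toℕ-fromℕ< (s≤s q′≤m)))

at-ext : ∀ {A : Set} {m} (v w : Vec A (suc m)) → (∀ q → q ≤ m → at v q ≡ at w q) → v ≡ w
at-ext v w v≗w = trans (sym (tabulate∘lookup v)) (trans (tabulate-cong pointwise) (tabulate∘lookup w))
  where
  pointwise : ∀ p → lookup v p ≡ lookup w p
  pointwise p = trans (lookup≡at v p) (trans (v≗w (toℕ p) (≤-pred (toℕ<n p))) (sym (lookup≡at w p)))

double : ℕ → ℕ
double zero    = zero
double (suc m) = suc (suc (double m))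

double≡+ : ∀ k → double k ≡ k + k
double≡+ zero    = refl
double≡+ (suc k) = cong suc (trans (cong suc (double≡+ k)) (sym (+-suc k k)))

double-mono-≤ : ∀ {q k} → q ≤ k → double q ≤ double k
double-mono-≤ z≤n       = z≤n
double-mono-≤ (s≤s q≤k) = s≤s (s≤s (double-mono-≤ q≤k))

double-cancel-≤ : ∀ {q k} → double q ≤ suc (double k) → q ≤ k
double-cancel-≤ {zero}          _             = z≤n
double-cancel-≤ {suc q} {suc k} (s≤s (s≤s h)) = s≤s (double-cancel-≤ h)

double-injective : ∀ {a b} → double a ≡ double b → a ≡ b
double-injective {zero}  {zero}  _ = refl
double-injective {suc a} {suc b} e = cong suc (double-injective (suc-injective (suc-injective e)))

2+n≢n : ∀ {n : ℕ} → suc (suc n) ≢ n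
2+n≢n {suc n} e = 2+n≢n (suc-injective e)

data Parity : ℕ → Set where
  even : ∀ q → Parity (double q)
  odd  : ∀ q → Parity (suc (double q))

parity : ∀ i → Parity i
parity zero = even 0
parity (suc i) with parity i
... | even q = odd q
... | odd  q = even (suc q)

parity-even : ∀ q → parity (double q) ≡ even q
parity-even zero = refl
parity-even (suc q) rewrite parity-even q = refl

parity-odd : ∀ q → parity (suc (double q)) ≡ odd q
parity-odd q rewrite parity-even q = refl

parity-bounded : ∀ {k i} → i ≤ suc (double k) → (P : ℕ → Set) →
  (∀ q → q ≤ k → P (double q)) → (∀ q → q ≤ k → P (suc (double q))) → P i
parity-bounded {i = i} i≤t P P-even P-odd with parity i
... | even q = P-even q (double-cancel-≤ i≤t)
... | odd  q = P-odd q (double-cancel-≤ (<⇒≤ i≤t))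

_≟ᵥ_ : ∀ {n} (u w : Vertex n) → Dec (u ≡ w)
_≟ᵥ_ = ≡-dec _≟_ _≟_

joins? : ∀ {n} (u w : Vertex n) i j → Dec (Joins u w i j)
joins? u w i j = ((u ≟ᵥ inj₁ i) ×-dec (w ≟ᵥ inj₂ j)) ⊎-dec ((u ≟ᵥ inj₂ j) ×-dec (w ≟ᵥ inj₁ i))

does-sound : ∀ {P : Set} (d : Dec P) → does d ≡ true → P
does-sound (yes p) _ = p

EdgeSet-ext : ∀ {n} (E F : EdgeSet n) → (∀ i j → HasEdge E i j → HasEdge F i j) →
  (∀ i j → HasEdge F i j → HasEdge E i j) → E ≡ F
EdgeSet-ext E F E⊆F F⊆E = trans (sym (tabulate∘lookup E))
  (trans (tabulate-cong λ i → trans (sym (tabulate∘lookup (lookup E i)))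
           (trans (tabulate-cong λ j → true-ext (E⊆F i j) (F⊆E i j)) (tabulate∘lookup (lookup F i))))
         (tabulate∘lookup F))
  where
  true-ext : ∀ {x y : Bool} → (x ≡ true → y ≡ true) → (y ≡ true → x ≡ true) → x ≡ y
  true-ext {false} {false} _ _ = refl
  true-ext {true}  {true}  _ _ = refl
  true-ext {true}  {false} x⇒y _ with () ← x⇒y refl
  true-ext {false} {true}  _ y⇒x with () ← y⇒x refl

onLeft : ∀ {n} → Vertex n → Bool
onLeft (inj₁ _) = true
onLeft (inj₂ _) = false

Adjacent⇒Joins : ∀ {n} (u w : Vertex n) → Adjacent u w → ∃ λ i → ∃ λ j → Joins u w i j
Adjacent⇒Joins (inj₁ a) (inj₂ b) _ = a , b , inj₁ (refl , refl)
Adjacent⇒Joins (inj₂ b) (inj₁ a) _ = a , b , inj₂ (refl , refl)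

Adjacent-sym : ∀ {n} (u w : Vertex n) → Adjacent u w → Adjacent w u
Adjacent-sym (inj₁ _) (inj₂ _) _ = _
Adjacent-sym (inj₂ _) (inj₁ _) _ = _

Adjacent⇒onLeft : ∀ {n} (u w : Vertex n) → Adjacent u w → onLeft w ≡ not (onLeft u)
Adjacent⇒onLeft (inj₁ _) (inj₂ _) _ = refl
Adjacent⇒onLeft (inj₂ _) (inj₁ _) _ = refl

Joins-sym : ∀ {n} {u w : Vertex n} {i j} → Joins u w i j → Joins w u i j
Joins-sym (inj₁ (e , e′)) = inj₂ (e′ , e)
Joins-sym (inj₂ (e , e′)) = inj₁ (e′ , e)

Joins-unique : ∀ {n} {a b u w : Vertex n} {i j} → Joins a b i j → Joins u w i j →
  (u ≡ a × w ≡ b) ⊎ (u ≡ b × w ≡ a)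
Joins-unique (inj₁ (refl , refl)) (inj₁ (refl , refl)) = inj₁ (refl , refl)
Joins-unique (inj₁ (refl , refl)) (inj₂ (refl , refl)) = inj₂ (refl , refl)
Joins-unique (inj₂ (refl , refl)) (inj₁ (refl , refl)) = inj₂ (refl , refl)
Joins-unique (inj₂ (refl , refl)) (inj₂ (refl , refl)) = inj₁ (refl , refl)

Traverses : ∀ {n} → ℕ → (ℕ → Vertex n) → Fin n → Fin n → Set
Traverses t f i j = ∃ λ q → q < t × Joins (f q) (f (suc q)) i j

edges : ∀ {n} → ℕ → (ℕ → Vertex n) → EdgeSet n
edges t f = tabulate λ i → tabulate λ j → does (anyUpTo? (λ q → joins? (f q) (f (suc q)) i j) t)

edges⁻ : ∀ {n} t (f : ℕ → Vertex n) {i j} → HasEdge (edges t f) i j → Traverses t f i j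
edges⁻ t f {i} {j} h = does-sound (anyUpTo? (λ q → joins? (f q) (f (suc q)) i j) t)
  (trans (sym (trans (cong (λ r → lookup r j) (lookup∘tabulate _ i)) (lookup∘tabulate _ j))) h)

edges⁺ : ∀ {n} t (f : ℕ → Vertex n) {i j} → Traverses t f i j → HasEdge (edges t f) i j
edges⁺ t f {i} {j} e = trans (trans (cong (λ r → lookup r j) (lookup∘tabulate _ i)) (lookup∘tabulate _ j))
  (dec-true (anyUpTo? (λ q → joins? (f q) (f (suc q)) i j) t) e)

edges-cong : ∀ {n} t {f g : ℕ → Vertex n} → (∀ i → i ≤ t → f i ≡ g i) → edges t f ≡ edges t g
edges-cong t {f} {g} f≗g = EdgeSet-ext _ _
  (λ i j h → edges⁺ t g (transfer f≗g (edges⁻ t f h)))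
  (λ i j h → edges⁺ t f (transfer (λ i i≤t → sym (f≗g i i≤t)) (edges⁻ t g h)))
  where
  transfer : ∀ {f g : ℕ → Vertex _} {i j} → (∀ i → i ≤ t → f i ≡ g i) →
    Traverses t f i j → Traverses t g i j
  transfer {i = i} {j} f≗g (q , q<t , jn) =
    q , q<t , subst₂ (λ u w → Joins u w i j) (f≗g q (<⇒≤ q<t)) (f≗g (suc q) q<t) jn

Traverses-transfer : ∀ {n t} {f g : ℕ → Vertex n} → edges t f ≡ edges t g →
  ∀ {i j} → Traverses t f i j → Traverses t g i j
Traverses-transfer {t = t} {f} {g} e {i} {j} h =
  edges⁻ t g (subst (λ E → HasEdge E i j) e (edges⁺ t f h))

-- Paths are handled as vertex sequences f : ℕ → Vertex n of which only f 0, …, f t matter.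
IsPathSeq : ∀ {n} → ℕ → (ℕ → Vertex n) → Set
IsPathSeq t f =
  (∀ i j → i ≤ t → j ≤ t → f i ≡ f j → i ≡ j) × (∀ q → q < t → Adjacent (f q) (f (suc q)))

IsPathSeq⇒IsPathOf : ∀ {n} t (f : ℕ → Vertex n) → IsPathSeq t f →
  IsPathOf t n (tabulate (f ∘ toℕ)) (edges t f)
IsPathSeq⇒IsPathOf {n} t f (f-inj , f-adj) = record
  { distinct = λ p q e → toℕ-injective (f-inj _ _ (≤-pred (toℕ<n p)) (≤-pred (toℕ<n q))
                           (trans (sym (lk p)) (trans e (lk q))))
  ; adjacent = adjacent
  ; edges⇒   = edges⇒
  ; edges⇐   = edges⇐
  }
  where
  lk : ∀ p → lookup (tabulate (f ∘ toℕ)) p ≡ f (toℕ p)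
  lk = lookup∘tabulate (f ∘ toℕ)
  lk-step : ∀ (p : Fin t) → lookup (tabulate (f ∘ toℕ)) (inject₁ p) ≡ f (toℕ p)
  lk-step p = trans (lk (inject₁ p)) (cong f (toℕ-inject₁ p))
  adjacent : ∀ p → Adjacent (lookup (tabulate (f ∘ toℕ)) (inject₁ p)) (lookup (tabulate (f ∘ toℕ)) (suc p))
  adjacent p = subst₂ Adjacent (sym (lk-step p)) (sym (lk (suc p))) (f-adj (toℕ p) (toℕ<n p))
  edges⇒ : ∀ i j → HasEdge (edges t f) i j →
    ∃ λ p → Joins (lookup (tabulate (f ∘ toℕ)) (inject₁ p)) (lookup (tabulate (f ∘ toℕ)) (suc p)) i j
  edges⇒ i j h with edges⁻ t f h
  ... | q , q<t , jn = fromℕ< q<t ,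
    subst₂ (λ u w → Joins u w i j)
      (sym (trans (lk-step (fromℕ< q<t)) (cong f (toℕ-fromℕ< q<t))))
      (sym (trans (lk (suc (fromℕ< q<t))) (cong (f ∘ suc) (toℕ-fromℕ< q<t)))) jn
  edges⇐ : ∀ i j p → Joins (lookup (tabulate (f ∘ toℕ)) (inject₁ p)) (lookup (tabulate (f ∘ toℕ)) (suc p)) i j →
    HasEdge (edges t f) i j
  edges⇐ i j p jn =
    edges⁺ t f (toℕ p , toℕ<n p , subst₂ (λ u w → Joins u w i j) (lk-step p) (lk (suc p)) jn)

module IsPathOf⇒IsPathSeq {n t} {v : Vec (Vertex n) (suc t)} {E : EdgeSet n} (P : IsPathOf t n v E) where
  open IsPathOf P

  isPathSeq : IsPathSeq t (at v)
  isPathSeq = injective , adjacent′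
    where
    injective : ∀ i j → i ≤ t → j ≤ t → at v i ≡ at v j → i ≡ j
    injective i j i≤t j≤t e = trans (sym (toℕ-fromℕ< (s≤s i≤t)))
      (trans (cong toℕ (distinct _ _ (trans (lookup-fromℕ<≡at v i≤t) (trans e (sym (lookup-fromℕ<≡at v j≤t))))))
             (toℕ-fromℕ< (s≤s j≤t)))
    adjacent′ : ∀ q → q < t → Adjacent (at v q) (at v (suc q))
    adjacent′ q q<t = subst₂ Adjacent
      (trans (lookup-inject₁≡at v (fromℕ< q<t)) (cong (at v) (toℕ-fromℕ< q<t)))
      (trans (lookup≡at v (suc (fromℕ< q<t))) (cong (at v ∘ suc) (toℕ-fromℕ< q<t)))
      (adjacent (fromℕ< q<t))

  E≡edges : E ≡ edges t (at v)
  E≡edges = EdgeSet-ext E (edges t (at v))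
    (λ i j h → edges⁺ t (at v) (traverses (edges⇒ i j h)))
    (λ i j h → let (q , q<t , jn) = edges⁻ t (at v) h in edges⇐ i j (fromℕ< q<t) (joins q<t jn))
    where
    traverses : ∀ {i j} → (∃ λ p → Joins (lookup v (inject₁ p)) (lookup v (suc p)) i j) → Traverses t (at v) i j
    traverses {i} {j} (p , jn) =
      toℕ p , toℕ<n p , subst₂ (λ u w → Joins u w i j) (lookup-inject₁≡at v p) (lookup≡at v (suc p)) jn
    joins : ∀ {i j q} (q<t : q < t) → Joins (at v q) (at v (suc q)) i j →
      Joins (lookup v (inject₁ (fromℕ< q<t))) (lookup v (suc (fromℕ< q<t))) i j
    joins {i} {j} q<t jn = subst₂ (λ u w → Joins u w i j)
      (sym (trans (lookup-inject₁≡at v (fromℕ< q<t)) (cong (at v) (toℕ-fromℕ< q<t))))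
      (sym (trans (lookup≡at v (suc (fromℕ< q<t))) (cong (at v ∘ suc) (toℕ-fromℕ< q<t)))) jn

Linked : ∀ {n} → ℕ → (ℕ → Vertex n) → Vertex n → Vertex n → Set
Linked t f u w = ∃ λ i → ∃ λ j → Traverses t f i j × Joins u w i j

Linked-transfer : ∀ {n t} {f g : ℕ → Vertex n} → edges t f ≡ edges t g →
  ∀ {u w} → Linked t f u w → Linked t g u w
Linked-transfer e (i , j , h , jn) = i , j , Traverses-transfer e h , jn

module PathSeq {n t} {f : ℕ → Vertex n} (f-path : IsPathSeq t f) where
  f-injective : ∀ i j → i ≤ t → j ≤ t → f i ≡ f j → i ≡ j
  f-injective = proj₁ f-path

  f-adjacent : ∀ q → q < t → Adjacent (f q) (f (suc q))
  f-adjacent = proj₂ f-path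

  linked-cases : ∀ {i w} → i ≤ t → Linked t f (f i) w →
    (suc i ≤ t × w ≡ f (suc i)) ⊎ (∃ λ i′ → i ≡ suc i′ × w ≡ f i′)
  linked-cases {i} i≤t (_ , _ , (q , q<t , jq) , jw) with Joins-unique jq jw
  ... | inj₁ (fi≡fq , w≡) with refl ← f-injective i q i≤t (<⇒≤ q<t) fi≡fq = inj₁ (q<t , w≡)
  ... | inj₂ (fi≡fq+1 , w≡) with refl ← f-injective i (suc q) i≤t q<t fi≡fq+1 = inj₂ (q , refl , w≡)

  linked-next : ∀ q → q < t → Linked t f (f q) (f (suc q))
  linked-next q q<t with Adjacent⇒Joins _ _ (f-adjacent q q<t)
  ... | i , j , jn = i , j , (q , q<t , jn) , jn

  linked-previous : ∀ q → q < t → Linked t f (f (suc q)) (f q)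
  linked-previous q q<t with Adjacent⇒Joins _ _ (f-adjacent q q<t)
  ... | i , j , jn = i , j , (q , q<t , jn) , Joins-sym jn

  onLeft-odd : ∀ m → suc (double m) ≤ t → onLeft (f (suc (double m))) ≡ not (onLeft (f 0))
  onLeft-odd zero 1≤t = Adjacent⇒onLeft _ _ (f-adjacent 0 1≤t)
  onLeft-odd (suc m) h =
    trans (Adjacent⇒onLeft _ _ (f-adjacent (suc (suc (double m))) h))
      (trans (cong not (Adjacent⇒onLeft _ _ (f-adjacent (suc (double m)) (<⇒≤ h))))
        (trans (not-involutive _) (onLeft-odd m (<⇒≤ (<⇒≤ h)))))

  onLeft-even : ∀ m → double m ≤ t → onLeft (f (double m)) ≡ onLeft (f 0)
  onLeft-even zero    _ = refl
  onLeft-even (suc m) h = trans (Adjacent⇒onLeft _ _ (f-adjacent (suc (double m)) h))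
    (trans (cong not (onLeft-odd m (<⇒≤ h))) (not-involutive _))

-- A path with an odd number of edges has exactly one end on the left, so a vertex sequence
-- starting on the left is determined by its edges.
module LeftStartUnique {n k} {f g : ℕ → Vertex n}
  (f-path : IsPathSeq (suc (double k)) f) (g-path : IsPathSeq (suc (double k)) g)
  (same-edges : edges (suc (double k)) f ≡ edges (suc (double k)) g)
  (f-left : onLeft (f 0) ≡ true) (g-left : onLeft (g 0) ≡ true) where

  private
    t : ℕ
    t = suc (double k)
    module F = PathSeq f-path
    module G = PathSeq g-path

    f→g : ∀ {u w} → Linked t f u w → Linked t g u w
    f→g = Linked-transfer same-edges

    g→f : ∀ {u w} → Linked t g u w → Linked t f u w
    g→f = Linked-transfer (sym same-edges)

    only-neighbour-of-g0 : ∀ {w} → Linked t g (g 0) w → w ≡ g 1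
    only-neighbour-of-g0 l with G.linked-cases z≤n l
    ... | inj₁ (_ , w≡g1) = w≡g1

    only-neighbour-of-f0 : ∀ {w} → Linked t f (f 0) w → w ≡ f 1
    only-neighbour-of-f0 l with F.linked-cases z≤n l
    ... | inj₁ (_ , w≡f1) = w≡f1

    -- The first edge of g is the q-th edge of f; as g 0 has a single neighbour, it is f 0 → f 1.
    first-edge : ∀ q → q < t → (g 0 ≡ f q × g 1 ≡ f (suc q)) ⊎ (g 0 ≡ f (suc q) × g 1 ≡ f q) → g 0 ≡ f 0
    first-edge zero    _   (inj₁ (g0≡f0 , _)) = g0≡f0
    first-edge (suc q) q<t (inj₁ (g0≡ , g1≡)) = ⊥-elim (2+n≢n (sym
      (F.f-injective _ _ (<⇒≤ (<⇒≤ q<t)) q<t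
        (trans (only-neighbour-of-g0 (subst (λ u → Linked t g u (f q)) (sym g0≡)
                  (f→g (F.linked-previous q (<⇒≤ q<t))))) g1≡))))
    first-edge q q<t (inj₂ (g0≡ , g1≡)) with m≤n⇒m<n∨m≡n q<t
    ... | inj₁ q+1<t = ⊥-elim (2+n≢n
      (F.f-injective _ _ q+1<t (<⇒≤ q<t)
        (trans (only-neighbour-of-g0 (subst (λ u → Linked t g u (f (suc (suc q)))) (sym g0≡)
                  (f→g (F.linked-next (suc q) q+1<t)))) g1≡)))
    ... | inj₂ refl with () ← trans (sym g-left) (trans (cong onLeft g0≡)
                               (trans (F.onLeft-odd k ≤-refl) (cong not f-left)))

    start-agrees : g 0 ≡ f 0
    start-agrees with Adjacent⇒Joins _ _ (G.f-adjacent 0 (s≤s z≤n))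
    ... | _ , _ , jn with g→f (_ , _ , (0 , s≤s z≤n , jn) , jn)
    ...   | _ , _ , (q , q<t , jq) , jn′ = first-edge q q<t (Joins-unique jq jn′)

    agree-step : ∀ i → suc i ≤ t → g i ≡ f i × g (suc i) ≡ f (suc i)
    agree-step zero _ = start-agrees ,
      only-neighbour-of-f0 (subst (λ u → Linked t f u (g 1)) start-agrees (g→f (G.linked-next 0 (s≤s z≤n))))
    agree-step (suc i) i+1<t with agree-step i (<⇒≤ i+1<t)
    ... | _ , gi+1≡ with F.linked-cases (<⇒≤ i+1<t)
           (subst (λ u → Linked t f u (g (suc (suc i)))) gi+1≡ (g→f (G.linked-next (suc i) i+1<t)))
    ...   | inj₁ (_ , gi+2≡) = gi+1≡ , gi+2≡
    ...   | inj₂ (_ , refl , gi+2≡fi) = ⊥-elim (2+n≢n (G.f-injective _ _ i+1<t (<⇒≤ (<⇒≤ i+1<t))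
                                          (trans gi+2≡fi (sym (proj₁ (agree-step i (<⇒≤ i+1<t)))))))

  agrees : ∀ i → i ≤ t → g i ≡ f i
  agrees zero    _     = start-agrees
  agrees (suc i) i<t = proj₂ (agree-step i i<t)

reverse : ∀ {n} → ℕ → (ℕ → Vertex n) → ℕ → Vertex n
reverse t f i = f (t ∸ i)

module Reverse {n t} {f : ℕ → Vertex n} (f-path : IsPathSeq t f) where
  open PathSeq f-path

  private
    t∸q≡1+t∸1+q : ∀ {t q} → q < t → t ∸ q ≡ suc (t ∸ suc q)
    t∸q≡1+t∸1+q {suc t} {zero}  _         = refl
    t∸q≡1+t∸1+q {suc t} {suc q} (s≤s q<t) = t∸q≡1+t∸1+q q<t

    mirror< : ∀ {q} → q < t → t ∸ suc q < t
    mirror< {q} q<t = subst (_≤ t) (t∸q≡1+t∸1+q q<t) (m∸n≤m t q)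

  isPathSeq : IsPathSeq t (reverse t f)
  isPathSeq = (λ i j i≤t j≤t e → ∸-cancelˡ-≡ i≤t j≤t (f-injective _ _ (m∸n≤m t i) (m∸n≤m t j) e)) ,
    (λ q q<t → subst (λ u → Adjacent u (f (t ∸ suc q))) (cong f (sym (t∸q≡1+t∸1+q q<t)))
                 (Adjacent-sym _ _ (f-adjacent _ (mirror< q<t))))

  same-edges : edges t f ≡ edges t (reverse t f)
  same-edges = EdgeSet-ext _ _ (λ i j h → edges⁺ t _ (forward (edges⁻ t f h)))
                               (λ i j h → edges⁺ t f (backward (edges⁻ t _ h)))
    where
    forward : ∀ {i j} → Traverses t f i j → Traverses t (reverse t f) i j
    forward {i} {j} (q , q<t , jn) = t ∸ suc q , mirror< q<t ,
      subst₂ (λ u w → Joins u w i j) (cong f (sym (m∸[m∸n]≡n q<t)))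
        (cong f (sym (trans (cong (t ∸_) (sym (t∸q≡1+t∸1+q q<t))) (m∸[m∸n]≡n (<⇒≤ q<t)))))
        (Joins-sym jn)
    backward : ∀ {i j} → Traverses t (reverse t f) i j → Traverses t f i j
    backward {i} {j} (q , q<t , jn) = t ∸ suc q , mirror< q<t ,
      Joins-sym (subst (λ u → Joins u (f (t ∸ suc q)) i j) (cong f (t∸q≡1+t∸1+q q<t)) jn)

canonical-form : ∀ {n k E} → IsTPath (suc (double k)) n E →
  ∃ λ g → IsPathSeq (suc (double k)) g × onLeft (g 0) ≡ true × E ≡ edges (suc (double k)) g
canonical-form {k = k} (v , P) with onLeft (at v 0) in starts-left
... | true  = at v , isPathSeq , starts-left , E≡edges
  where open IsPathOf⇒IsPathSeq P
... | false = reverse _ (at v) , Reverse.isPathSeq isPathSeq ,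
              trans (PathSeq.onLeft-odd isPathSeq k ≤-refl) (cong not starts-left) ,
              trans E≡edges (Reverse.same-edges isPathSeq)
  where open IsPathOf⇒IsPathSeq P

VertexOf-edges⁻ : ∀ {n t} (f : ℕ → Vertex n) w → VertexOf (edges t f) w → ∃ λ i → i ≤ t × f i ≡ w
VertexOf-edges⁻ {t = t} f (inj₁ x) (_ , h) with edges⁻ t f h
... | q , q<t , inj₁ (e , _) = q , <⇒≤ q<t , e
... | q , q<t , inj₂ (_ , e) = suc q , q<t , e
VertexOf-edges⁻ {t = t} f (inj₂ y) (_ , h) with edges⁻ t f h
... | q , q<t , inj₁ (_ , e) = suc q , q<t , e
... | q , q<t , inj₂ (e , _) = q , <⇒≤ q<t , e

Joins⇒VertexOf : ∀ {n} {E : EdgeSet n} {u w i j} → Joins u w i j → HasEdge E i j → VertexOf E u × VertexOf E w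
Joins⇒VertexOf {i = i} {j} (inj₁ (refl , refl)) h = (j , h) , (i , h)
Joins⇒VertexOf {i = i} {j} (inj₂ (refl , refl)) h = (i , h) , (j , h)

VertexOf-edges⁺ : ∀ {n t} (f : ℕ → Vertex n) → IsPathSeq (suc t) f →
  ∀ i → i ≤ suc t → VertexOf (edges (suc t) f) (f i)
VertexOf-edges⁺ {t = t} f (_ , f-adjacent) i i≤t+1 with m≤n⇒m<n∨m≡n i≤t+1
... | inj₁ i<t+1 with Adjacent⇒Joins _ _ (f-adjacent i i<t+1)
...   | _ , _ , jn = proj₁ (Joins⇒VertexOf jn (edges⁺ (suc t) f (i , i<t+1 , jn)))
VertexOf-edges⁺ {t = t} f (_ , f-adjacent) _ _ | inj₂ refl with Adjacent⇒Joins _ _ (f-adjacent t ≤-refl)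
...   | _ , _ , jn = proj₂ (Joins⇒VertexOf jn (edges⁺ (suc t) f (t , ≤-refl , jn)))

zigzag : ∀ {n k} → Vec (Fin n) (suc k) → Vec (Fin n) (suc k) → ℕ → Vertex n
zigzag ls rs i with parity i
... | even q = inj₁ (at ls q)
... | odd  q = inj₂ (at rs q)

zigzag-even : ∀ {n k} (ls rs : Vec (Fin n) (suc k)) q → zigzag ls rs (double q) ≡ inj₁ (at ls q)
zigzag-even ls rs q rewrite parity-even q = refl

zigzag-odd : ∀ {n k} (ls rs : Vec (Fin n) (suc k)) q → zigzag ls rs (suc (double q)) ≡ inj₂ (at rs q)
zigzag-odd ls rs q rewrite parity-odd q = refl

zigzag-isPathSeq : ∀ {n k} (ls rs : Vec (Fin n) (suc k)) → Distinct ls → Distinct rs →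
  IsPathSeq (suc (double k)) (zigzag ls rs)
zigzag-isPathSeq {k = k} ls rs ls-distinct rs-distinct = injective , adjacent
  where
  injective : ∀ i j → i ≤ suc (double k) → j ≤ suc (double k) → zigzag ls rs i ≡ zigzag ls rs j → i ≡ j
  injective i j i≤t j≤t e with parity i | parity j
  ... | even q | even q′
    with refl ← at-injective ls ls-distinct (double-cancel-≤ i≤t) (double-cancel-≤ j≤t) (inj₁-injective e) = refl
  ... | odd q  | odd q′
    with refl ← at-injective rs rs-distinct (double-cancel-≤ (<⇒≤ i≤t)) (double-cancel-≤ (<⇒≤ j≤t))
                  (inj₂-injective e) = refl
  adjacent : ∀ q → q < suc (double k) → Adjacent (zigzag ls rs q) (zigzag ls rs (suc q))
  adjacent q _ with parity q
  ... | even _ = _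
  ... | odd  _ = _

onLeft⇒inj₁ : ∀ {n} (u : Vertex n) → onLeft u ≡ true → inj₁ (reduce u) ≡ u
onLeft⇒inj₁ (inj₁ _) _ = refl

onRight⇒inj₂ : ∀ {n} (u : Vertex n) → onLeft u ≡ false → inj₂ (reduce u) ≡ u
onRight⇒inj₂ (inj₂ _) _ = refl

module Sides {n k} {g : ℕ → Vertex n} (g-path : IsPathSeq (suc (double k)) g) (g-left : onLeft (g 0) ≡ true) where
  open PathSeq g-path

  lefts rights : Vec (Fin n) (suc k)
  lefts  = tabulate (reduce ∘ g ∘ double ∘ toℕ)
  rights = tabulate (reduce ∘ g ∘ suc ∘ double ∘ toℕ)

  even≤t : ∀ (p : Fin (suc k)) → double (toℕ p) ≤ suc (double k)
  even≤t p = m≤n⇒m≤1+n (double-mono-≤ (≤-pred (toℕ<n p)))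

  odd≤t : ∀ (p : Fin (suc k)) → suc (double (toℕ p)) ≤ suc (double k)
  odd≤t p = s≤s (double-mono-≤ (≤-pred (toℕ<n p)))

  lookup-lefts : ∀ p → inj₁ (lookup lefts p) ≡ g (double (toℕ p))
  lookup-lefts p = trans (cong inj₁ (lookup∘tabulate (reduce ∘ g ∘ double ∘ toℕ) p))
    (onLeft⇒inj₁ _ (trans (onLeft-even _ (even≤t p)) g-left))

  lookup-rights : ∀ p → inj₂ (lookup rights p) ≡ g (suc (double (toℕ p)))
  lookup-rights p = trans (cong inj₂ (lookup∘tabulate (reduce ∘ g ∘ suc ∘ double ∘ toℕ) p))
    (onRight⇒inj₂ _ (trans (onLeft-odd _ (odd≤t p)) (cong not g-left)))

  lefts-distinct : Distinct lefts
  lefts-distinct p q e = toℕ-injective (double-injective (f-injective _ _ (even≤t p) (even≤t q)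
    (trans (sym (lookup-lefts p)) (trans (cong inj₁ e) (lookup-lefts q)))))

  rights-distinct : Distinct rights
  rights-distinct p q e = toℕ-injective (double-injective (suc-injective (f-injective _ _ (odd≤t p) (odd≤t q)
    (trans (sym (lookup-rights p)) (trans (cong inj₂ e) (lookup-rights q))))))

  at-lefts : ∀ {q} → q ≤ k → inj₁ (at lefts q) ≡ g (double q)
  at-lefts {q} q≤k = trans (cong inj₁ (sym (lookup-fromℕ<≡at lefts q≤k)))
    (trans (lookup-lefts _) (cong (g ∘ double) (toℕ-fromℕ< (s≤s q≤k))))

  at-rights : ∀ {q} → q ≤ k → inj₂ (at rights q) ≡ g (suc (double q))
  at-rights {q} q≤k = trans (cong inj₂ (sym (lookup-fromℕ<≡at rights q≤k)))
    (trans (lookup-rights _) (cong (g ∘ suc ∘ double) (toℕ-fromℕ< (s≤s q≤k))))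

  zigzag-sides : ∀ i → i ≤ suc (double k) → zigzag lefts rights i ≡ g i
  zigzag-sides i i≤t = parity-bounded i≤t (λ i → zigzag lefts rights i ≡ g i)
    (λ q q≤k → trans (zigzag-even lefts rights q) (at-lefts q≤k))
    (λ q q≤k → trans (zigzag-odd lefts rights q) (at-rights q≤k))

InSides : ∀ {n} → Sub n → Sub n → Vertex n → Set
InSides L R (inj₁ i) = i ∈ₛ L
InSides L R (inj₂ j) = j ∈ₛ R

Within : ∀ {n} → Sub n → Sub n → EdgeSet n → Set
Within L R E = ∀ w → VertexOf E w → InSides L R w

PathWithin : ∀ {n} → ℕ → Sub n → Sub n → Set
PathWithin {n} t L R = Σ (EdgeSet n) λ E → IsTPath t n E × Within L R E

module PathFromSides {n} (k : ℕ) (L R : Sub n) where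
  private
    t : ℕ
    t = suc (double k)

  SidePair : Set
  SidePair = Graph {A = Arrangement L (suc k)} (λ _ → Arranged {m = suc k} R)

  zigzag-within : ∀ ls rs → (∀ p → lookup ls p ∈ₛ L) → (∀ p → lookup rs p ∈ₛ R) →
    Within L R (edges t (zigzag ls rs))
  zigzag-within ls rs ls∈L rs∈R w w∈ with VertexOf-edges⁻ {t = t} (zigzag ls rs) w w∈
  ... | i , i≤t , refl = parity-bounded i≤t (λ i → InSides L R (zigzag ls rs i))
    (λ q q≤k → subst (InSides L R) (sym (zigzag-even ls rs q))
                 (subst (_∈ₛ L) (lookup-fromℕ<≡at ls q≤k) (ls∈L _)))
    (λ q q≤k → subst (InSides L R) (sym (zigzag-odd ls rs q))
                 (subst (_∈ₛ R) (lookup-fromℕ<≡at rs q≤k) (rs∈R _)))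

  path : SidePair → PathWithin t L R
  path ((ls , ls∈L , ls-distinct) , rs , rs∈R , rs-distinct) =
    edges t (zigzag ls rs) ,
    (_ , IsPathSeq⇒IsPathOf t _ (zigzag-isPathSeq ls rs ls-distinct rs-distinct)) ,
    zigzag-within ls rs ls∈L rs∈R

  path-cong : ∀ z z′ → ((_≡_ on proj₁) ×≈ _≡_) z z′ → proj₁ (path z) ≡ proj₁ (path z′)
  path-cong _ _ (refl , refl) = refl

  path-injective : ∀ z z′ → proj₁ (path z) ≡ proj₁ (path z′) → ((_≡_ on proj₁) ×≈ _≡_) z z′
  path-injective ((ls , _ , ls-distinct) , rs , _ , rs-distinct)
                 ((ls′ , _ , ls′-distinct) , rs′ , _ , rs′-distinct) e =
    at-ext ls ls′ (λ q q≤k → inj₁-injective (trans (sym (zigzag-even ls rs q))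
      (trans (sym (agrees (double q) (m≤n⇒m≤1+n (double-mono-≤ q≤k)))) (zigzag-even ls′ rs′ q)))) ,
    at-ext rs rs′ (λ q q≤k → inj₂-injective (trans (sym (zigzag-odd ls rs q))
      (trans (sym (agrees (suc (double q)) (s≤s (double-mono-≤ q≤k)))) (zigzag-odd ls′ rs′ q))))
    where
    open LeftStartUnique {k = k} (zigzag-isPathSeq ls rs ls-distinct rs-distinct)
      (zigzag-isPathSeq ls′ rs′ ls′-distinct rs′-distinct) e refl refl

  path-onto : ∀ (P : PathWithin t L R) → ∃ λ z → proj₁ (path z) ≡ proj₁ P
  path-onto (E , E-path , E-within) with canonical-form {k = k} E-path
  ... | g , g-path , g-left , E≡ =
    ((lefts , lefts∈L , lefts-distinct) , rights , rights∈R , rights-distinct) ,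
    trans (edges-cong t zigzag-sides) (sym E≡)
    where
    open Sides g-path g-left
    g-vertex : ∀ i → i ≤ t → VertexOf E (g i)
    g-vertex i i≤t = subst (λ F → VertexOf F (g i)) (sym E≡) (VertexOf-edges⁺ g g-path i i≤t)
    lefts∈L : ∀ p → lookup lefts p ∈ₛ L
    lefts∈L p = subst (InSides L R) (sym (lookup-lefts p)) (E-within _ (g-vertex _ (even≤t p)))
    rights∈R : ∀ p → lookup rights p ∈ₛ R
    rights∈R p = subst (InSides L R) (sym (lookup-rights p)) (E-within _ (g-vertex _ (odd≤t p)))

card-PathWithin : ∀ {n} k (L R : Sub n) {a b} → HasSize L a → HasSize R b →
  HasCardUpTo (PathWithin (suc (double k)) L R) (_≡_ on proj₁) (a ↓ suc k * b ↓ suc k)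
card-PathWithin k L R size-L size-R =
  card-transport ≡-on-proj₁ path path-cong path-injective path-onto
    (card-Graph {_≈B_ = _≡_} ≡-on-proj₁ (λ _ _ _ _ q → q) (card-Arrangement L (suc k) size-L)
      (λ _ → card-Arrangement R (suc k) size-R))
  where open PathFromSides k L R

VertexOf? : ∀ {n} (E : EdgeSet n) w → Dec (VertexOf E w)
VertexOf? E (inj₁ i) = any? λ j → lookup (lookup E i) j Bool.≟ true
VertexOf? E (inj₂ j) = any? λ i → lookup (lookup E i) j Bool.≟ true

leftsOf rightsOf : ∀ {n} → EdgeSet n → Sub n
leftsOf  E i = does (VertexOf? E (inj₁ i))
rightsOf E j = does (VertexOf? E (inj₂ j))

∈-leftsOf⁻ : ∀ {n} {E : EdgeSet n} {i} → i ∈ₛ leftsOf E → VertexOf E (inj₁ i)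
∈-leftsOf⁻ {E = E} {i} = does-sound (VertexOf? E (inj₁ i))

∈-leftsOf⁺ : ∀ {n} {E : EdgeSet n} {i} → VertexOf E (inj₁ i) → i ∈ₛ leftsOf E
∈-leftsOf⁺ {E = E} {i} = dec-true (VertexOf? E (inj₁ i))

∈-rightsOf⁻ : ∀ {n} {E : EdgeSet n} {j} → j ∈ₛ rightsOf E → VertexOf E (inj₂ j)
∈-rightsOf⁻ {E = E} {j} = does-sound (VertexOf? E (inj₂ j))

∈-rightsOf⁺ : ∀ {n} {E : EdgeSet n} {j} → VertexOf E (inj₂ j) → j ∈ₛ rightsOf E
∈-rightsOf⁺ {E = E} {j} = dec-true (VertexOf? E (inj₂ j))

module SideSizes {n} (k : ℕ) {E : EdgeSet n} (E-path : IsTPath (suc (double k)) n E) where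
  private
    t : ℕ
    t = suc (double k)
    canonical : ∃ λ g → IsPathSeq t g × onLeft (g 0) ≡ true × E ≡ edges t g
    canonical = canonical-form {k = k} E-path
    g : ℕ → Vertex n
    g = proj₁ canonical
    g-path : IsPathSeq t g
    g-path = proj₁ (proj₂ canonical)
    E≡ : E ≡ edges t g
    E≡ = proj₂ (proj₂ (proj₂ canonical))
    open Sides g-path (proj₁ (proj₂ (proj₂ canonical)))

    g-vertex : ∀ i → i ≤ t → VertexOf E (g i)
    g-vertex i i≤t = subst (λ F → VertexOf F (g i)) (sym E≡) (VertexOf-edges⁺ g g-path i i≤t)

    vertex-index : ∀ w → VertexOf E w → ∃ λ i → i ≤ t × g i ≡ w
    vertex-index w w∈ = VertexOf-edges⁻ {t = t} g w (subst (λ F → VertexOf F w) E≡ w∈)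

  size-leftsOf : HasSize (leftsOf E) (suc k)
  size-leftsOf = f , onto , lefts-distinct
    where
    f : Fin (suc k) → Σ (Fin n) (_∈ₛ leftsOf E)
    f p = lookup lefts p , ∈-leftsOf⁺ {E = E} (subst (VertexOf E) (sym (lookup-lefts p)) (g-vertex _ (even≤t p)))
    onto : ∀ z → ∃ λ p → lookup lefts p ≡ proj₁ z
    onto (i , i∈) with vertex-index (inj₁ i) (∈-leftsOf⁻ {E = E} i∈)
    ... | m , m≤t , gm≡ = parity-bounded m≤t (λ m → g m ≡ inj₁ i → ∃ λ p → lookup lefts p ≡ i)
      (λ q q≤k e → fromℕ< (s≤s q≤k) , inj₁-injective (trans (lookup-lefts _)
                     (trans (cong (g ∘ double) (toℕ-fromℕ< (s≤s q≤k))) e)))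
      (λ q q≤k e → case trans (at-rights q≤k) e of λ ())
      gm≡

  size-rightsOf : HasSize (rightsOf E) (suc k)
  size-rightsOf = f , onto , rights-distinct
    where
    f : Fin (suc k) → Σ (Fin n) (_∈ₛ rightsOf E)
    f p = lookup rights p , ∈-rightsOf⁺ {E = E} (subst (VertexOf E) (sym (lookup-rights p)) (g-vertex _ (odd≤t p)))
    onto : ∀ z → ∃ λ p → lookup rights p ≡ proj₁ z
    onto (j , j∈) with vertex-index (inj₂ j) (∈-rightsOf⁻ {E = E} j∈)
    ... | m , m≤t , gm≡ = parity-bounded m≤t (λ m → g m ≡ inj₂ j → ∃ λ p → lookup rights p ≡ j)
      (λ q q≤k e → case trans (at-lefts q≤k) e of λ ())
      (λ q q≤k e → fromℕ< (s≤s q≤k) , inj₂-injective (trans (lookup-rights _)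
                     (trans (cong (g ∘ suc ∘ double) (toℕ-fromℕ< (s≤s q≤k))) e)))
      gm≡

PathThrough : ∀ {n} → ℕ → Fin n → Sub n → Sub n → Set
PathThrough t x L R = Σ (PathWithin t L R) λ P → VertexOf (proj₁ P) (inj₁ x)

Within-∖⁅⁆ : ∀ {n} {L R : Sub n} {x E} → Within (L ∖ ⁅ x ⁆) R E → Within L R E
Within-∖⁅⁆ {L = L} {x = x} W (inj₁ i) v = proj₁ (∈-∖⁻ L ⁅ x ⁆ i (W (inj₁ i) v))
Within-∖⁅⁆ W (inj₂ j) v = W (inj₂ j) v

Within-∖⁅⁆⇒∉ : ∀ {n} {L R : Sub n} {x E} → Within (L ∖ ⁅ x ⁆) R E → ¬ VertexOf E (inj₁ x)
Within-∖⁅⁆⇒∉ {L = L} {x = x} W v = proj₂ (∈-∖⁻ L ⁅ x ⁆ x (W (inj₁ x) v)) (x∈⁅x⁆ x)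

Within-∉⇒∖⁅⁆ : ∀ {n} {L R : Sub n} {x E} → Within L R E → ¬ VertexOf E (inj₁ x) →
  Within (L ∖ ⁅ x ⁆) R E
Within-∉⇒∖⁅⁆ {L = L} {x = x} {E} W x∉E (inj₁ i) v =
  ∈-∖⁺ L ⁅ x ⁆ i (W (inj₁ i) v)
    (λ i∈⁅x⁆ → x∉E (subst (λ z → VertexOf E (inj₁ z)) (∈-⁅⁆⁻ i∈⁅x⁆) v))
Within-∉⇒∖⁅⁆ W x∉E (inj₂ j) v = W (inj₂ j) v

module PathThroughSplit {n} (t : ℕ) (x : Fin n) (L R : Sub n) where
  private
    L-x : Sub n
    L-x = L ∖ ⁅ x ⁆
    _≈_ : Rel (PathWithin t L-x R ⊎ PathThrough t x L R) 0ℓ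
    _≈_ = Pointwise (_≡_ on proj₁) ((_≡_ on proj₁) on proj₁)

  merge : PathWithin t L-x R ⊎ PathThrough t x L R → PathWithin t L R
  merge (inj₁ (E , E-path , W)) = E , E-path , Within-∖⁅⁆ W
  merge (inj₂ (P , _))           = P

  merge-cong : ∀ z z′ → z ≈ z′ → proj₁ (merge z) ≡ proj₁ (merge z′)
  merge-cong _ _ (inj₁ e) = e
  merge-cong _ _ (inj₂ e) = e

  merge-injective : ∀ z z′ → proj₁ (merge z) ≡ proj₁ (merge z′) → z ≈ z′
  merge-injective (inj₁ _) (inj₁ _) e = inj₁ e
  merge-injective (inj₂ _) (inj₂ _) e = inj₂ e
  merge-injective (inj₁ (_ , _ , W)) (inj₂ (_ , v)) refl = ⊥-elim (Within-∖⁅⁆⇒∉ W v)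
  merge-injective (inj₂ (_ , v)) (inj₁ (_ , _ , W)) refl = ⊥-elim (Within-∖⁅⁆⇒∉ W v)

  merge-onto : ∀ (P : PathWithin t L R) → ∃ λ z → proj₁ (merge z) ≡ proj₁ P
  merge-onto (E , E-path , W) with VertexOf? E (inj₁ x)
  ... | yes x∈E = inj₂ ((E , E-path , W) , x∈E) , refl
  ... | no  x∉E = inj₁ (E , E-path , Within-∉⇒∖⁅⁆ W x∉E) , refl

card-PathThrough : ∀ {n} k (x : Fin n) (L R : Sub n) {a b} → x ∈ₛ L → HasSize L (suc a) → HasSize R b →
  HasCardUpTo (PathThrough (suc (double k)) x L R) ((_≡_ on proj₁) on proj₁) (suc k * a ↓ k * b ↓ suc k)
card-PathThrough k x L R {a} {b} x∈L size-L size-R =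
  subst (HasCardUpTo (PathThrough t x L R) ((_≡_ on proj₁) on proj₁)) m≡ (proj₂ through)
  where
  t K : ℕ
  t = suc (double k)
  K = suc k
  open PathThroughSplit t x L R
  through : ∃ (HasCardUpTo (PathThrough t x L R) ((_≡_ on proj₁) on proj₁))
  through = card-Σ-dec ≡-on-proj₁ (λ P → VertexOf (proj₁ P) (inj₁ x)) (λ P → VertexOf? (proj₁ P) (inj₁ x))
    (λ { refl v → v }) (card-PathWithin k L R size-L size-R)
  m : ℕ
  m = proj₁ through
  split : a ↓ K * b ↓ K + m ≡ suc a ↓ K * b ↓ K
  split = card-unique ≡-on-proj₁
    (card-transport ≡-on-proj₁ merge merge-cong merge-injective merge-onto
      (card-⊎ (card-PathWithin k (L ∖ ⁅ x ⁆) R (size-remove L x∈L size-L) size-R) (proj₂ through)))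
    (card-PathWithin k L R size-L size-R)
  m≡ : m ≡ K * a ↓ k * b ↓ K
  m≡ = +-cancelˡ-≡ (a ↓ K * b ↓ K) m (K * a ↓ k * b ↓ K) (begin
    a ↓ K * b ↓ K + m                  ≡⟨ split ⟩
    suc a ↓ K * b ↓ K                  ≡⟨ cong (_* b ↓ K) (↓-pascal a k) ⟩
    (a ↓ K + K * a ↓ k) * b ↓ K        ≡⟨ *-distribʳ-+ (b ↓ K) (a ↓ K) (K * a ↓ k) ⟩
    a ↓ K * b ↓ K + K * a ↓ k * b ↓ K  ∎)

PathSetWithin : ∀ {n} → ℕ → Sub n → Sub n → ℕ → Set
PathSetWithin {n} t L R j = Σ (PathSet t n j) λ S → All (Within L R) (proj₁ S)

≈S-isEquivalence : ∀ {t n j} → IsEquivalence (_≈S_ {t} {n} {j})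
≈S-isEquivalence = record
  { refl  = λ _ → (λ m → m) , (λ m → m)
  ; sym   = λ e E → proj₂ (e E) , proj₁ (e E)
  ; trans = λ e e′ E → (λ m → proj₁ (e′ E) (proj₁ (e E) m)) , (λ m → proj₂ (e E) (proj₂ (e′ E) m))
  }

-- Fix x in a left side of size a + 1: either x is unused, or it lies on one of the
-- (k + 1) · a↓k · b↓(k + 1) paths through x and the other j paths avoid that path.
pathSetCount : ℕ → ℕ → ℕ → ℕ → ℕ
pathSetCount k zero    a       b = 1
pathSetCount k (suc j) zero    b = 0
pathSetCount k (suc j) (suc a) b =
  pathSetCount k (suc j) a b + (suc k * a ↓ k * b ↓ suc k) * pathSetCount k j (suc a ∸ suc k) (b ∸ suc k)

Avoids : ∀ {n} → Sub n → Sub n → EdgeSet n → EdgeSet n → Set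
Avoids L R E = Within (L ∖ leftsOf E) (R ∖ rightsOf E)

Avoids⇒Within : ∀ {n} {L R : Sub n} E {F} → Avoids L R E F → Within L R F
Avoids⇒Within {L = L} E A (inj₁ i) v = proj₁ (∈-∖⁻ L (leftsOf E) i (A (inj₁ i) v))
Avoids⇒Within {R = R} E A (inj₂ j) v = proj₁ (∈-∖⁻ R (rightsOf E) j (A (inj₂ j) v))

Avoids⇒VertexDisjoint : ∀ {n} {L R : Sub n} E {F} → Avoids L R E F → VertexDisjoint E F
Avoids⇒VertexDisjoint {L = L} E A (inj₁ i) v v′ =
  proj₂ (∈-∖⁻ L (leftsOf E) i (A (inj₁ i) v′)) (∈-leftsOf⁺ {E = E} v)
Avoids⇒VertexDisjoint {R = R} E A (inj₂ j) v v′ =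
  proj₂ (∈-∖⁻ R (rightsOf E) j (A (inj₂ j) v′)) (∈-rightsOf⁺ {E = E} v)

VertexDisjoint⇒Avoids : ∀ {n} {L R : Sub n} E {F} → Within L R F → VertexDisjoint E F → Avoids L R E F
VertexDisjoint⇒Avoids {L = L} E W d (inj₁ i) v =
  ∈-∖⁺ L (leftsOf E) i (W (inj₁ i) v) (λ i∈ → d (inj₁ i) (∈-leftsOf⁻ {E = E} i∈) v)
VertexDisjoint⇒Avoids {R = R} E W d (inj₂ j) v =
  ∈-∖⁺ R (rightsOf E) j (W (inj₂ j) v) (λ j∈ → d (inj₂ j) (∈-rightsOf⁻ {E = E} j∈) v)

module PathSetSplit {n} (k j : ℕ) (L R : Sub n) (x : Fin n) where
  private
    t : ℕ
    t = suc (double k)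
    L-x : Sub n
    L-x = L ∖ ⁅ x ⁆

  pathEdges : PathThrough t x L R → EdgeSet n
  pathEdges P = proj₁ (proj₁ P)

  Rest : PathThrough t x L R → PathSet t n j → Set
  Rest P S = All (Avoids L R (pathEdges P)) (proj₁ S)

  Split : Set
  Split = PathSetWithin t L-x R (suc j) ⊎ Graph Rest

  _≈_ : Rel Split 0ℓ
  _≈_ = Pointwise (_≈S_ on proj₁) (((_≡_ on proj₁) on proj₁) ×≈ _≈S_)

  merge : Split → PathSetWithin t L R (suc j)
  merge (inj₁ (S , W)) = S , All.map Within-∖⁅⁆ W
  merge (inj₂ (((E , E-path , E-within) , x∈E) , (S , S-unique , S-length , S-paths , S-disjoint) , rest)) =
    (E ∷ S , E∉S ∷ S-unique , cong suc S-length , E-path ∷ S-paths , E-disjoint ∷ S-disjoint) ,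
    E-within ∷ All.map (Avoids⇒Within E) rest
    where
    E-disjoint : All (VertexDisjoint E) S
    E-disjoint = All.map (Avoids⇒VertexDisjoint E) rest
    E∉S : All (λ F → ¬ E ≡ F) S
    E∉S = All.tabulate λ {F} F∈S E≡F →
      All.lookup E-disjoint F∈S (inj₁ x) x∈E (subst (λ F → VertexOf F (inj₁ x)) E≡F x∈E)

  merge-cong : ∀ z z′ → z ≈ z′ → proj₁ (merge z) ≈S proj₁ (merge z′)
  merge-cong _ _ (inj₁ e) = e
  merge-cong _ _ (inj₂ (refl , e)) F =
    (λ { (here r) → here r ; (there m) → there (proj₁ (e F) m) }) ,
    (λ { (here r) → here r ; (there m) → there (proj₂ (e F) m) })

  merge-injective : ∀ z z′ → proj₁ (merge z) ≈S proj₁ (merge z′) → z ≈ z′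
  merge-injective (inj₁ _) (inj₁ _) e = inj₁ e
  merge-injective (inj₁ (_ , W)) (inj₂ (((E , _) , x∈E) , _)) e =
    ⊥-elim (Within-∖⁅⁆⇒∉ (All.lookup W (proj₂ (e E) (here refl))) x∈E)
  merge-injective (inj₂ (((E , _) , x∈E) , _)) (inj₁ (_ , W)) e =
    ⊥-elim (Within-∖⁅⁆⇒∉ (All.lookup W (proj₁ (e E) (here refl))) x∈E)
  merge-injective (inj₂ (((E , _) , x∈E) , (S , _) , rest)) (inj₂ (((E′ , _) , x∈E′) , (S′ , _) , rest′)) e
    with proj₁ (e E) (here refl)
  ... | there E∈S′ = ⊥-elim (Avoids⇒VertexDisjoint E′ (All.lookup rest′ E∈S′) (inj₁ x) x∈E′ x∈E)
  ... | here refl = inj₂ (refl , λ F → tail-⊆ rest (proj₁ (e F)) , tail-⊆ rest′ (proj₂ (e F)))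
    where
    tail-⊆ : ∀ {S S′ F} → All (Avoids L R E) S → (F ∈ E ∷ S → F ∈ E ∷ S′) → F ∈ S → F ∈ S′
    tail-⊆ rest ⊆ F∈S with ⊆ (there F∈S)
    ... | here refl = ⊥-elim (Avoids⇒VertexDisjoint E (All.lookup rest F∈S) (inj₁ x) x∈E x∈E)
    ... | there F∈S′ = F∈S′

  merge-onto : ∀ (P : PathSetWithin t L R (suc j)) → ∃ λ z → proj₁ (merge z) ≈S proj₁ P
  merge-onto ((S , S-unique , S-length , S-paths , S-disjoint) , W)
    with Any.any? (λ E → VertexOf? E (inj₁ x)) S
  ... | no x∉S =
    inj₁ ((S , S-unique , S-length , S-paths , S-disjoint) , avoid x∉S W) , λ _ → (λ m → m) , (λ m → m)
    where
    avoid : ∀ {S} → ¬ Any (λ E → VertexOf E (inj₁ x)) S → All (Within L R) S → All (Within L-x R) S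
    avoid x∉S [] = []
    avoid x∉S (W ∷ Ws) = Within-∉⇒∖⁅⁆ W (x∉S ∘ here) ∷ avoid (x∉S ∘ there) Ws
  ... | yes x∈S = inj₂ (P , rest-set , rest) , same
    where
    E : EdgeSet n
    E = Any.lookup x∈S
    E∈S : E ∈ S
    E∈S = ∈-lookup (Any.index x∈S)
    P : PathThrough t x L R
    P = (E , All.lookup S-paths E∈S , All.lookup W E∈S) , lookup-result x∈S
    unique-rest : AllPairs (λ F G → ¬ F ≡ G) (S ─ x∈S) × All (λ F → ¬ E ≡ F) (S ─ x∈S)
    unique-rest = AllPairs-─ (λ E≢F F≡E → E≢F (sym F≡E)) x∈S S-unique
    disjoint-rest : AllPairs VertexDisjoint (S ─ x∈S) × All (VertexDisjoint E) (S ─ x∈S)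
    disjoint-rest = AllPairs-─ (λ d w v v′ → d w v′ v) x∈S S-disjoint
    rest-set : PathSet t n j
    rest-set = (S ─ x∈S) , proj₁ unique-rest ,
               suc-injective (trans (sym (length-removeAt′ S (Any.index x∈S))) S-length) ,
               All.─⁺ x∈S S-paths , proj₁ disjoint-rest
    rest : Rest P rest-set
    rest = All.tabulate λ F∈ →
      VertexDisjoint⇒Avoids E (All.lookup W (∈-─⁻ x∈S F∈)) (All.lookup (proj₂ disjoint-rest) F∈)
    same : ∀ F → (F ∈ E ∷ (S ─ x∈S) → F ∈ S) × (F ∈ S → F ∈ E ∷ (S ─ x∈S))
    same F = (λ { (here refl) → E∈S ; (there m) → ∈-─⁻ x∈S m }) ,
             (λ m → [ here , there ]′ (∈-─⁺ x∈S m))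

card-PathSetWithin : ∀ {n} k j {a b} (L R : Sub n) → HasSize L a → HasSize R b →
  HasCardUpTo (PathSetWithin (suc (double k)) L R j) (_≈S_ on proj₁) (pathSetCount k j a b)
card-PathSetWithin k zero L R _ _ =
  (λ _ → ([] , [] , refl , [] , []) , []) ,
  (λ { (([] , _) , _) → zero , λ _ → (λ m → m) , (λ m → m) }) ,
  (λ { zero zero _ → refl })
card-PathSetWithin k (suc j) {zero} L R size-L _ =
  (λ ()) , (λ { ((E ∷ _ , _ , _ , E-path ∷ _ , _) , W ∷ _) → ⊥-elim (no-left-vertex E-path W) }) , (λ ())
  where
  no-left-vertex : ∀ {E} → IsTPath (suc (double k)) _ E → ¬ Within L R E
  no-left-vertex {E} E-path W with proj₁ (SideSizes.size-leftsOf k E-path) zero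
  ... | i , i∈ = size-zero-empty L (W (inj₁ i) (∈-leftsOf⁻ {E = E} i∈)) size-L
card-PathSetWithin k (suc j) {suc a} {b} L R size-L size-R =
  card-transport (On.isEquivalence proj₁ ≈S-isEquivalence) merge merge-cong merge-injective merge-onto
    (card-⊎ (card-PathSetWithin k (suc j) (L ∖ ⁅ x ⁆) R (size-remove L x∈L size-L) size-R)
            (card-Graph {_≈B_ = _≈S_} (On.isEquivalence proj₁ ≡-on-proj₁) (λ { _ _ _ refl r → r })
              (card-PathThrough k x L R x∈L size-L size-R) rest-count))
  where
  x : Fin _
  x = proj₁ (proj₁ size-L zero)
  x∈L : x ∈ₛ L
  x∈L = proj₂ (proj₁ size-L zero)
  open PathSetSplit k j L R x
  rest-count : ∀ P → HasCardUpTo (Σ (PathSet _ _ j) (Rest P)) (_≈S_ on proj₁)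
                                 (pathSetCount k j (suc a ∸ suc k) (b ∸ suc k))
  rest-count ((E , E-path , W) , _) = card-PathSetWithin k j (L ∖ leftsOf E) (R ∖ rightsOf E)
    (size-∖ L (leftsOf E) (λ i i∈ → W (inj₁ i) (∈-leftsOf⁻ {E = E} i∈))
      size-L (SideSizes.size-leftsOf k E-path))
    (size-∖ R (rightsOf E) (λ i i∈ → W (inj₂ i) (∈-rightsOf⁻ {E = E} i∈))
      size-R (SideSizes.size-rightsOf k E-path))

pathSetCount-closed : ∀ k j a b → j ! * pathSetCount k j a b ≡ a ↓ (j * suc k) * b ↓ (j * suc k)
pathSetCount-closed k zero    a       b = refl
pathSetCount-closed k (suc j) zero    b = *-zeroʳ (suc j !)
pathSetCount-closed k (suc j) (suc a) b = begin
  suc j ! * (C₁ + K * a ↓ k * b ↓ K * C₂)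
    ≡⟨ distribute j (j !) C₁ k (a ↓ k) (b ↓ K) C₂ ⟩
  suc j ! * C₁ + M * (a ↓ k * b ↓ K * (j ! * C₂))
    ≡⟨ cong₂ (λ x y → x + M * (a ↓ k * b ↓ K * y))
             (pathSetCount-closed k (suc j) a b) (pathSetCount-closed k j (a ∸ k) (b ∸ K)) ⟩
  a ↓ M * b ↓ M + M * (a ↓ k * b ↓ K * ((a ∸ k) ↓ (j * K) * (b ∸ K) ↓ (j * K)))
    ≡⟨ cong (λ z → a ↓ M * b ↓ M + M * z) (interchange (a ↓ k) (b ↓ K) _ _) ⟩
  a ↓ M * b ↓ M + M * ((a ↓ k * (a ∸ k) ↓ (j * K)) * (b ↓ K * (b ∸ K) ↓ (j * K)))
    ≡⟨ cong₂ (λ x y → a ↓ M * b ↓ M + M * (x * y)) (sym (↓-+ a k (j * K))) (sym (↓-+ b K (j * K))) ⟩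
  a ↓ M * b ↓ M + M * (a ↓ (k + j * K) * b ↓ M)
    ≡⟨ factor (a ↓ M) (b ↓ M) M (a ↓ (k + j * K)) ⟩
  (a ↓ M + M * a ↓ (k + j * K)) * b ↓ M
    ≡⟨ cong (_* b ↓ M) (sym (↓-pascal a (k + j * K))) ⟩
  suc a ↓ M * b ↓ M
    ∎
  where
  K M C₁ C₂ : ℕ
  K = suc k
  M = suc j * K
  C₁ = pathSetCount k (suc j) a b
  C₂ = pathSetCount k j (a ∸ k) (b ∸ K)
  distribute : ∀ j f c k x y d →
    (suc j * f) * (c + suc k * x * y * d) ≡ (suc j * f) * c + suc j * suc k * (x * y * (f * d))
  distribute = solve-∀
  interchange : ∀ x y z w → x * y * (z * w) ≡ (x * z) * (y * w)
  interchange = solve-∀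
  factor : ∀ x y m z → x * y + m * (z * y) ≡ (x + m * z) * y
  factor = solve-∀

card-PathSet : ∀ k n j → HasCardUpTo (PathSet (suc (double k)) n j) _≈S_ (pathSetCount k j n n)
card-PathSet k n j = card-transport ≈S-isEquivalence proj₁ (λ _ _ e → e) (λ _ _ e → e)
  (λ S → (S , All.tabulate λ {E} _ → within-everything E) , IsEquivalence.refl ≈S-isEquivalence {S})
  (card-PathSetWithin k j everything everything size-everything size-everything)
  where
  everything : Sub n
  everything _ = true
  size-everything : HasSize everything n
  size-everything = (λ i → i , refl) , (λ { (i , _) → i , refl }) , (λ _ _ e → e)
  within-everything : ∀ E → Within everything everything E
  within-everything E (inj₁ _) _ = refl
  within-everything E (inj₂ _) _ = refl

count-closed : ∀ k c → IsPathSetCount (suc (double k)) c →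
  ∀ n j → j ! * c n j ≡ n ↓ (j * suc k) * n ↓ (j * suc k)
count-closed k c c-counts n j =
  trans (cong (j ! *_) (card-unique ≈S-isEquivalence (c-counts n j) (card-PathSet k n j))) (pathSetCount-closed k j n n)

module CountRecurrence (k : ℕ) (c : ℕ → ℕ → ℕ)
  (closed : ∀ n j → j ! * c n j ≡ n ↓ (j * suc k) * n ↓ (j * suc k)) where

  K t : ℕ
  K = suc k
  t = suc (double k)

  A B : ℕ → ℕ
  A n = (K !) ^ 2 * ((n C k) ^ 2 + 2 * (n C K) * (n C k))
  B n = ((n C t) * (t C K) * (K !) ^ 2) ^ 2

  count-zero : ∀ n → c n 0 ≡ 1
  count-zero n = trans (sym (+-identityʳ (c n 0))) (closed n 0)

  count-empty : ∀ {n j} → n < j * K → c n j ≡ 0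
  count-empty {n} {j} n<jK = *-cancelˡ-≡ (c n j) 0 (j !) ⦃ j !≢0 ⦄
    (trans (closed n j) (trans (cong (_* n ↓ (j * K)) (↓-zero n<jK)) (sym (*-zeroʳ (j !)))))

  A≡ : ∀ n → A n ≡ K * K * (n ↓ k * n ↓ k) + 2 * K * n ↓ K * n ↓ k
  A≡ n = begin
    (K !) ^ 2 * ((n C k) ^ 2 + 2 * (n C K) * (n C k))
      ≡⟨ cong₂ (λ x y → x * (y + 2 * (n C K) * (n C k))) (^2≡* (K !)) (^2≡* (n C k)) ⟩
    (K * k !) * (K * k !) * ((n C k) * (n C k) + 2 * (n C K) * (n C k))
      ≡⟨ expand K (k !) (n C k) (n C K) ⟩
    K * K * (((n C k) * k !) * ((n C k) * k !)) + 2 * K * ((n C K) * (K * k !)) * ((n C k) * k !)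
      ≡⟨ cong₂ (λ x y → K * K * (x * x) + 2 * K * y * x) (C*!≡↓ n k) (C*!≡↓ n K) ⟩
    K * K * (n ↓ k * n ↓ k) + 2 * K * n ↓ K * n ↓ k
      ∎
    where
    expand : ∀ x f a b → (x * f) * (x * f) * (a * a + 2 * b * a) ≡
                         x * x * ((a * f) * (a * f)) + 2 * x * (b * (x * f)) * (a * f)
    expand = solve-∀

  B≡ : ∀ n → B n ≡ K * K * (n ↓ t * n ↓ t)
  B≡ n = begin
    ((n C t) * (t C K) * (K !) ^ 2) ^ 2  ≡⟨ ^2≡* X ⟩
    X * X                                ≡⟨ cong (λ x → x * x) X≡ ⟩
    (K * n ↓ t) * (K * n ↓ t)            ≡⟨ interchange K (n ↓ t) ⟩
    K * K * (n ↓ t * n ↓ t)              ∎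
    where
    X : ℕ
    X = (n C t) * (t C K) * (K !) ^ 2
    t↓K*k!≡t! : t ↓ K * k ! ≡ t !
    t↓K*k!≡t! = subst (λ z → z ↓ K * k ! ≡ z !) (cong suc (sym (double≡+ k))) (↓*!≡! K k)
    regroup : ∀ x f u v → u * v * ((x * f) * (x * f)) ≡ x * (u * ((v * (x * f)) * f))
    regroup = solve-∀
    interchange : ∀ x y → (x * y) * (x * y) ≡ x * x * (y * y)
    interchange = solve-∀
    X≡ : X ≡ K * n ↓ t
    X≡ = begin
      (n C t) * (t C K) * (K !) ^ 2                  ≡⟨ cong ((n C t) * (t C K) *_) (^2≡* (K !)) ⟩
      (n C t) * (t C K) * ((K * k !) * (K * k !))    ≡⟨ regroup K (k !) (n C t) (t C K) ⟩
      K * ((n C t) * (((t C K) * K !) * k !))        ≡⟨ cong (λ z → K * ((n C t) * (z * k !))) (C*!≡↓ t K) ⟩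
      K * ((n C t) * (t ↓ K * k !))                  ≡⟨ cong (λ z → K * ((n C t) * z)) t↓K*k!≡t! ⟩
      K * ((n C t) * t !)                            ≡⟨ cong (K *_) (C*!≡↓ n t) ⟩
      K * n ↓ t                                      ∎

  -- For n = k + j K + d, multiplying the counts c (n + 1) (j + 1), c n (j + 1), c (n − k) j and
  -- c (n − t) (j − 1) by factorials turns them into G² times polynomials in j, d and K, with G = n↓(k + j K).
  module AtIndex (j d n : ℕ) (n≡ : n ≡ k + j * K + d) where
    m G Y : ℕ
    m = k + j * K
    G = n ↓ m
    Y = (n ∸ k) ↓ (j * K)

    n∸m≡d : n ∸ m ≡ d
    n∸m≡d = trans (cong (_∸ m) n≡) (m+n∸m≡n m d)

    n∸k≡ : n ∸ k ≡ j * K + d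
    n∸k≡ = trans (cong (_∸ k) (trans n≡ (+-assoc k (j * K) d))) (m+n∸m≡n k (j * K + d))

    n↓1+m≡ : n ↓ suc m ≡ G * d
    n↓1+m≡ = trans (↓-suc n m) (cong (G *_) n∸m≡d)

    1+n↓1+m≡ : suc n ↓ suc m ≡ G * d + suc j * K * G
    1+n↓1+m≡ = trans (↓-pascal n m) (cong (_+ suc m * G) n↓1+m≡)

    n↓k*Y≡G : n ↓ k * Y ≡ G
    n↓k*Y≡G = sym (↓-+ n k (j * K))

    n↓K*Y≡ : n ↓ K * Y ≡ (j * K + d) * G
    n↓K*Y≡ = begin
      n ↓ K * Y                  ≡⟨ cong (_* Y) (↓-suc n k) ⟩
      n ↓ k * (n ∸ k) * Y        ≡⟨ cong (λ z → n ↓ k * z * Y) n∸k≡ ⟩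
      n ↓ k * (j * K + d) * Y    ≡⟨ swap (n ↓ k) (j * K + d) Y ⟩
      (j * K + d) * (n ↓ k * Y)  ≡⟨ cong ((j * K + d) *_) n↓k*Y≡G ⟩
      (j * K + d) * G            ∎
      where
      swap : ∀ x y z → x * y * z ≡ y * (x * z)
      swap = solve-∀

    closed-next : suc j ! * c (suc n) (suc j) ≡ (G * d + suc j * K * G) * (G * d + suc j * K * G)
    closed-next = trans (closed (suc n) (suc j)) (cong₂ _*_ 1+n↓1+m≡ 1+n↓1+m≡)

    closed-same : suc j ! * c n (suc j) ≡ (G * d) * (G * d)
    closed-same = trans (closed n (suc j)) (cong₂ _*_ n↓1+m≡ n↓1+m≡)

    closed-A : suc j ! * (A n * c (n ∸ k) j) ≡ suc j * (K * K * (G * G) + 2 * K * (j * K + d) * (G * G))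
    closed-A = begin
      suc j * j ! * (A n * c (n ∸ k) j)
        ≡⟨ regroup (suc j) (j !) (A n) (c (n ∸ k) j) ⟩
      suc j * (A n * (j ! * c (n ∸ k) j))
        ≡⟨ cong (λ z → suc j * (A n * z)) (closed (n ∸ k) j) ⟩
      suc j * (A n * (Y * Y))
        ≡⟨ cong (λ z → suc j * (z * (Y * Y))) (A≡ n) ⟩
      suc j * ((K * K * (n ↓ k * n ↓ k) + 2 * K * n ↓ K * n ↓ k) * (Y * Y))
        ≡⟨ cong (suc j *_) (distribute K (n ↓ k) (n ↓ K) Y) ⟩
      suc j * (K * K * ((n ↓ k * Y) * (n ↓ k * Y)) + 2 * K * (n ↓ K * Y) * (n ↓ k * Y))
        ≡⟨ cong₂ (λ x y → suc j * (K * K * (x * x) + 2 * K * y * x)) n↓k*Y≡G n↓K*Y≡ ⟩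
      suc j * (K * K * (G * G) + 2 * K * ((j * K + d) * G) * G)
        ≡⟨ cong (suc j *_) (reassociate K G (j * K + d)) ⟩
      suc j * (K * K * (G * G) + 2 * K * (j * K + d) * (G * G))
        ∎
      where
      regroup : ∀ x f a y → x * f * (a * y) ≡ x * (a * (f * y))
      regroup = solve-∀
      distribute : ∀ x a b y → (x * x * (a * a) + 2 * x * b * a) * (y * y) ≡
                               x * x * ((a * y) * (a * y)) + 2 * x * (b * y) * (a * y)
      distribute = solve-∀
      reassociate : ∀ x g e → x * x * (g * g) + 2 * x * (e * g) * g ≡ x * x * (g * g) + 2 * x * e * (g * g)
      reassociate = solve-∀

  square-of-sum : ∀ g d j x → (g * d + suc j * x * g) * (g * d + suc j * x * g) + suc j * j * (x * x * (g * g)) ≡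
                              (g * d) * (g * d) + suc j * (x * x * (g * g) + 2 * x * (j * x + d) * (g * g))
  square-of-sum = solve-∀

  count-recurrence-first : ∀ d n → n ≡ k + 0 * K + d → c (suc n) 1 ≡ c n 1 + A n * c (n ∸ k) 0
  count-recurrence-first d n n≡ = *-cancelˡ-≡ _ _ 1 (begin
    1 ! * c (suc n) 1
      ≡⟨ closed-next ⟩
    (G * d + 1 * K * G) * (G * d + 1 * K * G)
      ≡⟨ trans (sym (+-identityʳ _)) (square-of-sum G d 0 K) ⟩
    (G * d) * (G * d) + 1 * (K * K * (G * G) + 2 * K * (0 * K + d) * (G * G))
      ≡⟨ cong₂ _+_ (sym closed-same) (sym closed-A) ⟩
    1 ! * c n 1 + 1 ! * (A n * c (n ∸ k) 0)
      ≡⟨ sym (*-distribˡ-+ (1 !) (c n 1) _) ⟩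
    1 ! * (c n 1 + A n * c (n ∸ k) 0)
      ∎)
    where open AtIndex 0 d n n≡

  count-recurrence : ∀ j d n → n ≡ k + suc j * K + d →
    c (suc n) (2 + j) + B n * c (n ∸ t) j ≡ c n (2 + j) + A n * c (n ∸ k) (suc j)
  count-recurrence j d n n≡ = *-cancelˡ-≡ _ _ ((2 + j) !) ⦃ (2 + j) !≢0 ⦄ (begin
    (2 + j) ! * (c (suc n) (2 + j) + B n * c (n ∸ t) j)
      ≡⟨ distribute j (j !) (c (suc n) (2 + j)) (B n) (c (n ∸ t) j) ⟩
    (2 + j) ! * c (suc n) (2 + j) + (2 + j) * suc j * (B n * (j ! * c (n ∸ t) j))
      ≡⟨ cong₂ (λ x y → x + (2 + j) * suc j * (B n * y)) closed-next (closed (n ∸ t) j) ⟩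
    (G * d + (2 + j) * K * G) * (G * d + (2 + j) * K * G) + (2 + j) * suc j * (B n * (W * W))
      ≡⟨ cong (λ z → (G * d + (2 + j) * K * G) * (G * d + (2 + j) * K * G) + (2 + j) * suc j * z) B*W²≡ ⟩
    (G * d + (2 + j) * K * G) * (G * d + (2 + j) * K * G) + (2 + j) * suc j * (K * K * (G * G))
      ≡⟨ square-of-sum G d (suc j) K ⟩
    (G * d) * (G * d) + (2 + j) * (K * K * (G * G) + 2 * K * (suc j * K + d) * (G * G))
      ≡⟨ cong₂ _+_ (sym closed-same) (sym closed-A) ⟩
    (2 + j) ! * c n (2 + j) + (2 + j) ! * (A n * c (n ∸ k) (suc j))
      ≡⟨ sym (*-distribˡ-+ ((2 + j) !) (c n (2 + j)) _) ⟩
    (2 + j) ! * (c n (2 + j) + A n * c (n ∸ k) (suc j))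
      ∎)
    where
    open AtIndex (suc j) d n n≡
    W : ℕ
    W = (n ∸ t) ↓ (j * K)
    t+jK≡m : t + j * K ≡ m
    t+jK≡m = trans (cong (λ z → suc z + j * K) (double≡+ k)) (shift k j)
      where
      shift : ∀ k j → suc (k + k) + j * suc k ≡ k + suc j * suc k
      shift = solve-∀
    n↓t*W≡G : n ↓ t * W ≡ G
    n↓t*W≡G = trans (sym (↓-+ n t (j * K))) (cong (n ↓_) t+jK≡m)
    B*W²≡ : B n * (W * W) ≡ K * K * (G * G)
    B*W²≡ = begin
      B n * (W * W)                  ≡⟨ cong (_* (W * W)) (B≡ n) ⟩
      K * K * (n ↓ t * n ↓ t) * (W * W)  ≡⟨ regroup K (n ↓ t) W ⟩
      K * K * ((n ↓ t * W) * (n ↓ t * W)) ≡⟨ cong (λ z → K * K * (z * z)) n↓t*W≡G ⟩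
      K * K * (G * G)                ∎
      where
      regroup : ∀ x h w → x * x * (h * h) * (w * w) ≡ x * x * ((h * w) * (h * w))
      regroup = solve-∀
    distribute : ∀ j f a b y → (2 + j) * (suc j * f) * (a + b * y) ≡
                                (2 + j) * (suc j * f) * a + (2 + j) * suc j * (b * (f * y))
    distribute = solve-∀

sumTo-zero : ∀ N (f : ℕ → ℤ) → (∀ j → j ≤ N → f j ≡ + 0) → sumTo N f ≡ + 0
sumTo-zero zero    f f≡0 = f≡0 0 z≤n
sumTo-zero (suc N) f f≡0 =
  cong₂ ℤ._+_ (sumTo-zero N f λ j j≤N → f≡0 j (m≤n⇒m≤1+n j≤N)) (f≡0 (suc N) ≤-refl)

sumTo-single : ∀ N (f : ℕ → ℤ) {j₀} → j₀ ≤ N → (∀ j → j ≢ j₀ → f j ≡ + 0) → sumTo N f ≡ f j₀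
sumTo-single zero    f z≤n       _    = refl
sumTo-single (suc N) f {j₀} j₀≤1+N only-j₀ with j₀ ≟ℕ suc N
... | yes refl = trans (cong (ℤ._+ f (suc N)) (sumTo-zero N f λ j j≤N → only-j₀ j λ { refl → 1+n≰n j≤N }))
                       (ℤₚ.+-identityˡ (f (suc N)))
... | no  j₀≢  = trans (cong₂ ℤ._+_ (sumTo-single N f (≤-pred (≤∧≢⇒< j₀≤1+N j₀≢)) only-j₀)
                                    (only-j₀ (suc N) (j₀≢ ∘ sym)))
                       (ℤₚ.+-identityʳ (f j₀))

module Coefficients (k : ℕ) (c : ℕ → ℕ → ℕ) where
  K t : ℕ
  K = suc k
  t = suc (double k)

  private
    exponent≡ : ∀ j d → (t + 1) * j + 2 * d ≡ 2 * (K * j + d)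
    exponent≡ j d = trans (cong (λ z → (suc z + 1) * j + 2 * d) (double≡+ k)) (rearrange k j d)
      where
      rearrange : ∀ k j d → (suc (k + k) + 1) * j + 2 * d ≡ 2 * (suc k * j + d)
      rearrange = solve-∀

    matches : ∀ {n} j d → K * j + d ≡ n → ((t + 1) * j + 2 * d ≡ᵇ 2 * n) ≡ true
    matches {n} j d e = Equivalence.to T-≡ (≡⇒≡ᵇ _ _ (trans (exponent≡ j d) (cong (2 *_) e)))

    mismatches : ∀ {n} j d → K * j + d ≢ n → ((t + 1) * j + 2 * d ≡ᵇ 2 * n) ≡ false
    mismatches {n} j d ne = ¬-not λ h →
      ne (*-cancelˡ-≡ _ _ 2 (trans (sym (exponent≡ j d)) (≡ᵇ⇒≡ _ _ (Equivalence.from T-≡ h))))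

    if-true : ∀ {b} {x y : ℤ} → b ≡ true → (if b then x else y) ≡ x
    if-true refl = refl

    if-false : ∀ {b} {x y : ℤ} → b ≡ false → (if b then x else y) ≡ y
    if-false refl = refl

  Lcoeff-hit : ∀ {n d} j → K * j + d ≡ n → Lcoeff t c n d ≡ signℤ j ℤ.* + c n j
  Lcoeff-hit {n} {d} j e = trans (sumTo-single (2 * n) _ j≤2n others) (if-true (matches j d e))
    where
    j≤2n : j ≤ 2 * n
    j≤2n = ≤-trans (m≤m+n j (k * j)) (≤-trans (m≤m+n (K * j) d)
             (subst (_≤ 2 * n) (sym e) (m≤m+n n (n + 0))))
    others : ∀ j′ → j′ ≢ j →
      (if (t + 1) * j′ + 2 * d ≡ᵇ 2 * n then signℤ j′ ℤ.* + c n j′ else + 0) ≡ + 0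
    others j′ j′≢j = if-false (mismatches j′ d λ e′ →
      j′≢j (*-cancelˡ-≡ j′ j K (+-cancelʳ-≡ d _ _ (trans e′ (sym e)))))

  Lcoeff-miss : ∀ {n d} → (∀ j → K * j + d ≢ n) → Lcoeff t c n d ≡ + 0
  Lcoeff-miss {n} {d} no-j = sumTo-zero (2 * n) _ λ j _ → if-false (mismatches j d (no-j j))

  LcoeffSub-≤ : ∀ {n m} d → m ≤ n → LcoeffSub t c n m d ≡ Lcoeff t c (n ∸ m) d
  LcoeffSub-≤ d m≤n = if-true (Equivalence.to T-≡ (≤⇒≤ᵇ m≤n))

  LcoeffSub-miss : ∀ n m d → (m ≤ n → ∀ j → K * j + d ≢ n ∸ m) → LcoeffSub t c n m d ≡ + 0
  LcoeffSub-miss n m d no-j with m ≤? n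
  ... | yes m≤n = trans (LcoeffSub-≤ d m≤n) (Lcoeff-miss (no-j m≤n))
  ... | no  m≰n = if-false (¬-not λ h → m≰n (≤ᵇ⇒≤ m n (Equivalence.from T-≡ h)))

drop-zero-terms : ∀ (x a b : ℤ) → x ≡ (x ℤ.- a ℤ.* + 0) ℤ.- b ℤ.* + 0
drop-zero-terms = ℤSolver.solve-∀

signed-recurrence : ∀ (s : ℤ) {c₁ c₂ c₃ c₄} a b → c₁ + b * c₄ ≡ c₂ + a * c₃ →
  (- - s) ℤ.* + c₁ ≡ ((- - s) ℤ.* + c₂ ℤ.- + a ℤ.* (- s ℤ.* + c₃)) ℤ.- + b ℤ.* (s ℤ.* + c₄)
signed-recurrence s {c₁} {c₂} {c₃} {c₄} a b e = begin
  (- - s) ℤ.* + c₁                                      ≡⟨ isolate s (+ c₁) (+ b) (+ c₄) ⟩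
  s ℤ.* ((+ c₁ ℤ.+ + b ℤ.* + c₄) ℤ.- + b ℤ.* + c₄)       ≡⟨ cong (λ z → s ℤ.* (z ℤ.- + b ℤ.* + c₄)) lifted ⟩
  s ℤ.* ((+ c₂ ℤ.+ + a ℤ.* + c₃) ℤ.- + b ℤ.* + c₄)       ≡⟨ spread s (+ c₂) (+ a) (+ c₃) (+ b) (+ c₄) ⟩
  ((- - s) ℤ.* + c₂ ℤ.- + a ℤ.* (- s ℤ.* + c₃)) ℤ.- + b ℤ.* (s ℤ.* + c₄) ∎
  where
  pos : ∀ x y z → + (x + y * z) ≡ + x ℤ.+ + y ℤ.* + z
  pos x y z = trans (ℤₚ.pos-+ x (y * z)) (cong (λ w → + x ℤ.+ w) (ℤₚ.pos-* y z))
  lifted : + c₁ ℤ.+ + b ℤ.* + c₄ ≡ + c₂ ℤ.+ + a ℤ.* + c₃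
  lifted = trans (sym (pos c₁ b c₄)) (trans (cong +_ e) (pos c₂ a c₃))
  isolate : ∀ s x y z → (- - s) ℤ.* x ≡ s ℤ.* ((x ℤ.+ y ℤ.* z) ℤ.- y ℤ.* z)
  isolate = ℤSolver.solve-∀
  spread : ∀ s x a y b z → s ℤ.* ((x ℤ.+ a ℤ.* y) ℤ.- b ℤ.* z) ≡
                           ((- - s) ℤ.* x ℤ.- a ℤ.* (- s ℤ.* y)) ℤ.- b ℤ.* (s ℤ.* z)
  spread = ℤSolver.solve-∀

module Recurrence (k : ℕ) (c : ℕ → ℕ → ℕ)
  (closed : ∀ n j → j ! * c n j ≡ n ↓ (j * suc k) * n ↓ (j * suc k)) where
  open CountRecurrence k c closed
  open Coefficients k c using (Lcoeff-hit; Lcoeff-miss; LcoeffSub-≤; LcoeffSub-miss)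

  RHS : ℕ → ℕ → ℤ
  RHS n d = (xTimes (Lcoeff t c n) d ℤ.- + A n ℤ.* LcoeffSub t c n k d) ℤ.- + B n ℤ.* LcoeffSub t c n t d

  private
    RHS≡ : ∀ n d {x y z} → xTimes (Lcoeff t c n) d ≡ x → LcoeffSub t c n k d ≡ y → LcoeffSub t c n t d ≡ z →
      RHS n d ≡ (x ℤ.- + A n ℤ.* y) ℤ.- + B n ℤ.* z
    RHS≡ n d refl refl refl = refl

    K*1≡ : K * 1 ≡ suc k
    K*1≡ = *-identityʳ K

    K*2≡ : K * 2 ≡ suc t
    K*2≡ = trans (twice k) (cong (λ z → suc (suc z)) (sym (double≡+ k)))
      where
      twice : ∀ k → suc k * 2 ≡ suc (suc (k + k))
      twice = solve-∀

    shift : ∀ i j {m n d} → K * i ≡ suc m → m ≤ n → K * j + d ≡ n ∸ m → K * (i + j) + d ≡ suc n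
    shift i j {m} {n} {d} Ki≡ m≤n e = begin
      K * (i + j) + d    ≡⟨ cong (_+ d) (*-distribˡ-+ K i j) ⟩
      K * i + K * j + d  ≡⟨ +-assoc (K * i) (K * j) d ⟩
      K * i + (K * j + d) ≡⟨ cong₂ _+_ Ki≡ e ⟩
      suc m + (n ∸ m)    ≡⟨ cong suc (m+[n∸m]≡n m≤n) ⟩
      suc n              ∎

    below : ∀ n m j → K * j + suc n ≢ n ∸ m
    below n m j e = 1+n≰n (≤-trans (m≤n+m (suc n) (K * j)) (≤-trans (≤-reflexive e) (m∸n≤m n m)))

    index< : ∀ {j d n} → K * j + d ≡ suc n → j < suc (suc n)
    index< {j} {d} e = s≤s (≤-trans (m≤m+n j (k * j + d)) (≤-reflexive (trans (sym (+-assoc j (k * j) d)) e)))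

    level : ∀ {j d n} → K * suc j + d ≡ suc n → n ≡ k + j * K + d
    level {j} {d} e = sym (suc-injective (trans (sym (unfold k j d)) e))
      where
      unfold : ∀ k j d → suc k * suc j + d ≡ suc (k + j * suc k + d)
      unfold = solve-∀

  no-term : ∀ n d → (∀ j → K * j + d ≢ suc n) → Lcoeff t c (suc n) d ≡ RHS n d
  no-term n d no-j = trans (Lcoeff-miss no-j) (trans (drop-zero-terms (+ 0) (+ A n) (+ B n)) (sym (RHS≡ n d x≡0
    (LcoeffSub-miss n k d λ k≤n j e → no-j (1 + j) (shift 1 j K*1≡ k≤n e))
    (LcoeffSub-miss n t d λ t≤n j e → no-j (2 + j) (shift 2 j K*2≡ t≤n e)))))
    where
    x≡0 : xTimes (Lcoeff t c n) d ≡ + 0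
    x≡0 = xTimes-miss d no-j
      where
      xTimes-miss : ∀ d → (∀ j → K * j + d ≢ suc n) → xTimes (Lcoeff t c n) d ≡ + 0
      xTimes-miss zero     _    = refl
      xTimes-miss (suc d′) no-j = Lcoeff-miss λ j e → no-j j (trans (+-suc (K * j) d′) (cong suc e))

  constant-term : ∀ n → Lcoeff t c (suc n) (suc n) ≡ RHS n (suc n)
  constant-term n = begin
    Lcoeff t c (suc n) (suc n)  ≡⟨ Lcoeff-hit 0 (cong (_+ suc n) (*-zeroʳ K)) ⟩
    + 1 ℤ.* + c (suc n) 0       ≡⟨ cong (λ z → + 1 ℤ.* + z) (count-zero (suc n)) ⟩
    + 1                         ≡⟨ drop-zero-terms (+ 1) (+ A n) (+ B n) ⟩
    (+ 1 ℤ.- + A n ℤ.* + 0) ℤ.- + B n ℤ.* + 0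
      ≡⟨ sym (RHS≡ n (suc n)
               (trans (Lcoeff-hit 0 (cong (_+ n) (*-zeroʳ K))) (cong (λ z → + 1 ℤ.* + z) (count-zero n)))
               (LcoeffSub-miss n k (suc n) λ _ → below n k) (LcoeffSub-miss n t (suc n) λ _ → below n t)) ⟩
    RHS n (suc n)               ∎

  private
    x-term : ∀ n d j → K * suc j + d ≡ suc n → xTimes (Lcoeff t c n) d ≡ signℤ (suc j) ℤ.* + c n (suc j)
    x-term n zero j hit = trans (sym (ℤₚ.*-zeroʳ (signℤ (suc j))))
      (cong (λ z → signℤ (suc j) ℤ.* + z)
        (sym (count-empty (s≤s (≤-reflexive (trans (level hit) (+-identityʳ _)))))))
    x-term n (suc d) j hit = Lcoeff-hit (suc j) (suc-injective (trans (sym (+-suc (K * suc j) d)) hit))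

    y-term : ∀ n d j → K * suc j + d ≡ suc n → LcoeffSub t c n k d ≡ signℤ j ℤ.* + c (n ∸ k) j
    y-term n d j hit = trans (LcoeffSub-≤ d k≤n) (Lcoeff-hit j (trans (cong (_+ d) (*-comm K j)) (sym n∸k≡)))
      where
      open AtIndex j d n (level hit) using (n∸k≡)
      k≤n : k ≤ n
      k≤n = subst (k ≤_) (sym (level hit)) (≤-trans (m≤m+n k (j * K)) (m≤m+n _ d))

    z-term-first : ∀ n d → K * 1 + d ≡ suc n → LcoeffSub t c n t d ≡ + 0
    z-term-first n d hit = LcoeffSub-miss n t d λ t≤n j e →
      1+n≢0 (suc-injective (*-cancelˡ-≡ (2 + j) 1 K (+-cancelʳ-≡ d _ _ (trans (shift 2 j K*2≡ t≤n e) (sym hit)))))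

    z-term : ∀ n d j → K * (2 + j) + d ≡ suc n → LcoeffSub t c n t d ≡ signℤ j ℤ.* + c (n ∸ t) j
    z-term n d j hit = trans (LcoeffSub-≤ d (subst (t ≤_) (sym n≡t+) (m≤m+n t _)))
      (Lcoeff-hit j (sym (trans (cong (_∸ t) n≡t+) (m+n∸m≡n t (K * j + d)))))
      where
      n≡t+ : n ≡ t + (K * j + d)
      n≡t+ = trans (level hit) (trans (regroup k j d) (cong (λ z → suc z + (K * j + d)) (sym (double≡+ k))))
        where
        regroup : ∀ k j d → k + suc j * suc k + d ≡ suc (k + k) + (suc k * j + d)
        regroup = solve-∀

  first-term : ∀ n d → K * 1 + d ≡ suc n → Lcoeff t c (suc n) d ≡ RHS n d
  first-term n d hit = begin
    Lcoeff t c (suc n) d  ≡⟨ Lcoeff-hit 1 hit ⟩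
    - + 1 ℤ.* + c (suc n) 1
      ≡⟨ signed-recurrence (- + 1) (A n) (B n) (trans (cong (λ z → c (suc n) 1 + z) (*-zeroʳ (B n)))
           (trans (+-identityʳ _) (count-recurrence-first d n (level hit)))) ⟩
    (- + 1 ℤ.* + c n 1 ℤ.- + A n ℤ.* (+ 1 ℤ.* + c (n ∸ k) 0)) ℤ.- + B n ℤ.* + 0
      ≡⟨ sym (RHS≡ n d (x-term n d 0 hit) (y-term n d 0 hit) (z-term-first n d hit)) ⟩
    RHS n d  ∎

  later-term : ∀ n d j → K * (2 + j) + d ≡ suc n → Lcoeff t c (suc n) d ≡ RHS n d
  later-term n d j hit = begin
    Lcoeff t c (suc n) d  ≡⟨ Lcoeff-hit (2 + j) hit ⟩
    signℤ (2 + j) ℤ.* + c (suc n) (2 + j)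
      ≡⟨ signed-recurrence (signℤ j) (A n) (B n) (count-recurrence j d n (level hit)) ⟩
    (signℤ (2 + j) ℤ.* + c n (2 + j) ℤ.- + A n ℤ.* (signℤ (suc j) ℤ.* + c (n ∸ k) (suc j))) ℤ.-
      + B n ℤ.* (signℤ j ℤ.* + c (n ∸ t) j)
      ≡⟨ sym (RHS≡ n d (x-term n d (suc j) hit) (y-term n d (suc j) hit) (z-term n d j hit)) ⟩
    RHS n d  ∎

  recurrence : ∀ n d → Lcoeff t c (suc n) d ≡ RHS n d
  recurrence n d with anyUpTo? (λ j → K * j + d ≟ℕ suc n) (suc (suc n))
  ... | no  none                  = no-term n d λ j e → none (j , index< e , e)
  ... | yes (zero , _ , hit)      = subst (λ d → Lcoeff t c (suc n) d ≡ RHS n d) (d≡ hit) (constant-term n)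
    where
    d≡ : K * 0 + d ≡ suc n → suc n ≡ d
    d≡ e = sym (trans (cong (_+ d) (sym (*-zeroʳ K))) e)
  ... | yes (suc zero , _ , hit)    = first-term n d hit
  ... | yes (suc (suc j) , _ , hit) = later-term n d j hit

t≡1+double : ∀ t k → t + 1 ≡ 2 * suc k → t ≡ suc (double k)
t≡1+double t k e = +-cancelʳ-≡ 1 t (suc (double k)) (trans e (trans (rearrange k)
  (cong (λ z → suc z + 1) (sym (double≡+ k)))))
  where
  rearrange : ∀ k → 2 * suc k ≡ suc (k + k) + 1
  rearrange = solve-∀

theorem6p1 : (t k : ℕ) → 1 ≤ k → t + 1 ≡ 2 * k →
    (c : ℕ → ℕ → ℕ) → IsPathSetCount t c →
    (n d : ℕ) →
    Lcoeff t c (suc n) d ≡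
      (xTimes (Lcoeff t c n) d
       -ℤ (+ ((k !) ^ 2 * ((n C (k ∸ 1)) ^ 2 + 2 * (n C k) * (n C (k ∸ 1))))
          *ℤ LcoeffSub t c n (k ∸ 1) d))
       -ℤ (+ (((n C t) * (t C k) * (k !) ^ 2) ^ 2) *ℤ LcoeffSub t c n t d)
theorem6p1 t (suc k) _ t+1≡2k c c-counts n d with refl ← t≡1+double t k t+1≡2k =
  Recurrence.recurrence k c (count-closed k c c-counts) n d
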